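{- Let $M=\{1^{k_{1}},2^{k_{2}},\ldots,m^{k_{m}}\}$ with $k_{i}\geq1$ for all $i\in[m]$, and let $r$ be a positive integer. Then $R(\mathcal{P}_M)=\mathcal{P}_M$, where $R$ is Rawlings' bijection (for the parameter $r$).
   Context: $\mathfrak{S}_M$: words that are rearrangements of $M$; $\mathcal{P}_M$: the words in $\mathfrak{S}_M$ in which the last occurrences of $1,2,\dots,m$ appear in this order. For a word $v=v_1\cdots v_k$, an $r$-descent is an index $i$ with $v_i\ge v_{i+1}+r$. Rawlings' map $R$ is defined recursively on $m$ (with $R$ of the empty word empty). Given $w\in\mathfrak{S}_M$, let $w'$ be the word obtained from $w$ by deleting all occurrences of $m$ (so $w'$ is a rearrangement of $\{1^{k_1},\dots,(m-1)^{k_{m-1}}\}$), and for $1\le j\le k_m$ let $u_j(m)$ be the number of letters of $w$ that lie to the right of the $j$th occurrence (from the left) of $m$ in $w$ and are smaller than $m$. Starting from $R(w')$, insert $k_m$ copies of $m$ one at a time, for $j=1,\dots,k_m$: in the current word, star the positions (gaps) immediately before each already inserted $m$; label the unstarred gaps with $0,1,2,\dots$ in order, first reading from right to left the gaps where inserting $m$ would not create a new $r$-descent, and then reading from left to right the gaps where inserting $m$ would create a new $r$-descent; insert the $j$th $m$ into the gap labeled $u_j(m)$. The word obtained after inserting all $k_m$ copies is $R(w)$. ($R$ is a bijection of $\mathfrak{S}_M$ with $\mathrm{INV}(w)=r\text{ - }\mathrm{MAJ}(R(w))$.) -}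

module Defs where

open import Data.Nat using (ℕ; zero; suc; _+_; _≤_; _<_; _≥_; _≤ᵇ_; _<ᵇ_; _≡ᵇ_)
open import Data.Bool using (Bool; true; false; if_then_else_; not; _∧_)
open import Data.List using (List; []; _∷_; _++_; take; drop; length; reverse; filter; replicate; concat)
open import Data.Maybe using (Maybe; just; nothing)
open import Data.Vec using (Vec; lookup; toList)
open import Data.Fin using (Fin; toℕ)
open import Data.Product using (Σ; _×_; ∃; ∃-syntax)
open import Relation.Binary.PropositionalEquality using (_≡_)
open import Data.List.Relation.Binary.Permutation.Propositional using (_↭_)
import Data.List as L

-- M = {1^{k_1}, ..., m^{k_m}} is encoded by the vector k of multiplicities;
-- letter (toℕ i + 1) has multiplicity lookup k i.
expandAux : ∀ {m} → ℕ → Vec ℕ m → List ℕ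
expandAux a Vec.[] = []
expandAux a (x Vec.∷ k) = replicate x a ++ expandAux (suc a) k

expand : ∀ {m} → Vec ℕ m → List ℕ
expand = expandAux 1

InS : ∀ {m} → Vec ℕ m → List ℕ → Set
InS k w = w ↭ expand k

lastOcc : ℕ → List ℕ → Maybe ℕ
lastOcc a [] = nothing
lastOcc a (x ∷ xs) with lastOcc a xs
... | just p = just (suc p)
... | nothing = if x ≡ᵇ a then just 0 else nothing

InP : ∀ {m} → Vec ℕ m → List ℕ → Set
InP {m} k w = InS k w ×
  (∀ a b → 1 ≤ a → a < b → b ≤ m →
     ∃[ p ] ∃[ q ] (lastOcc a w ≡ just p × lastOcc b w ≡ just q × p < q))

countLess : ℕ → List ℕ → ℕ
countLess m [] = 0
countLess m (x ∷ xs) = if x <ᵇ m then suc (countLess m xs) else countLess m xs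

us : ℕ → List ℕ → List ℕ
us m [] = []
us m (x ∷ xs) = if x ≡ᵇ m then countLess m xs ∷ us m xs else us m xs

deleteAll : ℕ → List ℕ → List ℕ
deleteAll m [] = []
deleteAll m (x ∷ xs) = if x ≡ᵇ m then deleteAll m xs else x ∷ deleteAll m xs

rdesc : ℕ → ℕ → ℕ → Bool
rdesc r x y = (y + r) ≤ᵇ x

-- gap i of v (0 ≤ i ≤ length v) lies immediately before v_i (0-based);
-- gap (length v) is the right end.
-- Gap i is starred iff v_i = m (it lies immediately before an inserted m).
starred : ℕ → List ℕ → ℕ → Bool
starred m [] i = false
starred m (x ∷ xs) zero = x ≡ᵇ m
starred m (x ∷ xs) (suc i) = starred m xs i

at : List ℕ → ℕ → Maybe ℕ
at [] i = nothing
at (x ∷ xs) zero = just x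
at (x ∷ xs) (suc i) = at xs i

-- Inserting m into gap i creates a new r-descent iff the number of
-- r-descents increases: with neighbours a = v_{i-1}, b = v_i,
-- the pair (a,b) is replaced by (a,m),(m,b); (a,m) is never an r-descent
-- (a ≤ m, r ≥ 1), so a new r-descent is created iff m ≥ b + r and
-- (a,b) was not an r-descent (or a does not exist).
createsNew : ℕ → ℕ → List ℕ → ℕ → Bool
createsNew r m v i with at v i
... | nothing = false
... | just b with i
...   | zero = rdesc r m b
...   | suc i' with at v i'
...     | nothing = rdesc r m b
...     | just a = rdesc r m b ∧ not (rdesc r a b)

gaps : ℕ → List ℕ
gaps n = L.upTo (suc n)

-- labelled gaps: label ℓ ↦ ℓ-th element of this list
labelled : ℕ → ℕ → List ℕ → List ℕ
labelled r m v =
  reverse (filter (λ i → Data.Bool._≟_ (starred m v i ∨' createsNew r m v i) false) (gaps (length v)))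
  ++ filter (λ i → Data.Bool._≟_ (not (starred m v i) ∧ createsNew r m v i) true) (gaps (length v))
  where
    open import Data.Bool using (_∨_)
    _∨'_ = _∨_

insertAt : ℕ → ℕ → List ℕ → List ℕ
insertAt i m v = take i v ++ m ∷ drop i v

-- insert one copy of m into the gap labelled u
-- (u is always in range for inputs from 𝔖_M; otherwise v is unchanged)
insertStep : ℕ → ℕ → ℕ → List ℕ → List ℕ
insertStep r m u v with at (labelled r m v) u
... | nothing = v
... | just i = insertAt i m v

insertAll : ℕ → ℕ → List ℕ → List ℕ → List ℕ
insertAll r m [] v = v
insertAll r m (u ∷ uu) v = insertAll r m uu (insertStep r m u v)

R : ℕ → ℕ → List ℕ → List ℕ
R r zero w = w
R r (suc m) w = insertAll r (suc m) (us (suc m) w) (R r m (deleteAll (suc m) w))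

{-# OPTIONS --safe #-}

-- With T = m + 1, a word w lies in 𝒫_M exactly when deleting
-- its T's gives a word of 𝒫 for the smaller multiset and w ends with T.  R(w)
-- inserts the T's into R(w') with labels u_1 ≥ u_2 ≥ ⋯; a final T of w gives
-- the label 0, and label 0 is always the right end, so R(w) ends with T again.
-- Conversely, a word v with T-free part v' is reached from v' by a nonincreasing
-- sequence of labels that contains 0 when v ends with T: first each gap that
-- must receive T's and would create a new descent gets one T while it is still
-- creating, from the right; then all remaining gaps are neutral and get their
-- missing T's from the left.  Any such sequence is the u-sequence of a word
-- with prescribed T-free part, and that word is a preimage of v under R.
module Submission where

open import Defs
open import Data.Nat using (ℕ; zero; suc; _+_; _∸_; _≤_; _<_; _≥_; z≤n; s≤s; z<s; _<ᵇ_; _≡ᵇ_)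
open import Data.Nat.Properties
open import Data.Bool using (Bool; true; false; if_then_else_; not; _∧_; _∨_)
open import Data.Bool.Properties using (T-≡; ∨-zeroʳ; ∨-identityʳ; ∧-zeroʳ; ∧-identityʳ; ∧-inverseʳ; ∧-conicalˡ)
open import Data.List
  using (List; []; _∷_; _++_; [_]; length; reverse; replicate; map; upTo; take; drop; initLast; _∷ʳ′_)
import Data.List.Properties as List
open import Data.Maybe using (Maybe; just; nothing)
import Data.Maybe as Maybe
open import Data.Vec using (Vec; lookup; _∷ʳ_)
import Data.Vec as Vec
import Data.Fin as Fin
open import Data.Product using (_×_; _,_; proj₁; proj₂; map₂; ∃-syntax)
open import Data.Sum using (_⊎_; inj₁; inj₂; [_,_]′)
open import Data.Empty using (⊥-elim)
open import Function using (id; _∘_)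
open import Function.Bundles using (Equivalence)
open import Relation.Nullary using (¬_; yes; no)
open import Relation.Binary.Definitions using (tri<; tri≈; tri>)
open import Relation.Binary.PropositionalEquality hiding ([_])
open import Data.List.Relation.Binary.Permutation.Propositional
  using (_↭_; prep; swap; ↭-sym; ↭-reflexive)
  renaming (refl to ↭-refl; trans to ↭-trans)
open import Data.List.Relation.Binary.Permutation.Propositional.Properties
  using (shift; ↭-length; ++-comm; ++⁺ˡ; All-resp-↭)
open import Data.List.Relation.Unary.All using (All; []; _∷_)
import Data.List.Relation.Unary.All as All
import Data.List.Relation.Unary.All.Properties as All
open import Data.List.Relation.Unary.AllPairs using (AllPairs; []; _∷_)
import Data.List.Relation.Unary.AllPairs.Properties as AllPairs

≡ᵇ-refl : ∀ x → (x ≡ᵇ x) ≡ true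
≡ᵇ-refl x = Equivalence.to T-≡ (≡⇒≡ᵇ x x refl)

≡ᵇ-true⇒≡ : ∀ x y → (x ≡ᵇ y) ≡ true → x ≡ y
≡ᵇ-true⇒≡ x y e = ≡ᵇ⇒≡ x y (Equivalence.from T-≡ e)

≡ᵇ-false⇒≢ : ∀ x y → (x ≡ᵇ y) ≡ false → x ≢ y
≡ᵇ-false⇒≢ x .x e refl with () ← trans (sym (≡ᵇ-refl x)) e

≢⇒≡ᵇ-false : ∀ x y → x ≢ y → (x ≡ᵇ y) ≡ false
≢⇒≡ᵇ-false x y x≢y with x ≡ᵇ y in eq
... | true = ⊥-elim (x≢y (≡ᵇ-true⇒≡ x y eq))
... | false = refl

<ᵇ-true⇒< : ∀ x y → (x <ᵇ y) ≡ true → x < y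
<ᵇ-true⇒< x y e = <ᵇ⇒< x y (Equivalence.from T-≡ e)

<⇒<ᵇ-true : ∀ {x y} → x < y → (x <ᵇ y) ≡ true
<⇒<ᵇ-true x<y = Equivalence.to T-≡ (<⇒<ᵇ x<y)

<ᵇ-false⇒≥ : ∀ x y → (x <ᵇ y) ≡ false → y ≤ x
<ᵇ-false⇒≥ x y e = ≮⇒≥ (λ x<y → true≢false (trans (sym (<⇒<ᵇ-true x<y)) e))
  where
  true≢false : true ≢ false
  true≢false ()

≥⇒<ᵇ-false : ∀ x y → y ≤ x → (x <ᵇ y) ≡ false
≥⇒<ᵇ-false x y y≤x with x <ᵇ y in eq
... | true = ⊥-elim (<⇒≱ (<ᵇ-true⇒< x y eq) y≤x)
... | false = refl

count : ℕ → List ℕ → ℕ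
count a [] = 0
count a (x ∷ xs) = if x ≡ᵇ a then suc (count a xs) else count a xs

occurs : ℕ → List ℕ → Bool
occurs a [] = false
occurs a (x ∷ xs) = if x ≡ᵇ a then true else occurs a xs

Avoids : ℕ → List ℕ → Set
Avoids a = All (_≢ a)

count-↭ : ∀ a {xs ys} → xs ↭ ys → count a xs ≡ count a ys
count-↭ a ↭-refl = refl
count-↭ a (prep x p) with x ≡ᵇ a
... | true = cong suc (count-↭ a p)
... | false = count-↭ a p
count-↭ a (swap x y p) with x ≡ᵇ a | y ≡ᵇ a
... | true | true = cong (suc ∘ suc) (count-↭ a p)
... | true | false = cong suc (count-↭ a p)
... | false | true = cong suc (count-↭ a p)
... | false | false = count-↭ a p
count-↭ a (↭-trans p q) = trans (count-↭ a p) (count-↭ a q)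

occurs-↭ : ∀ a {xs ys} → xs ↭ ys → occurs a xs ≡ occurs a ys
occurs-↭ a ↭-refl = refl
occurs-↭ a (prep x p) with x ≡ᵇ a
... | true = refl
... | false = occurs-↭ a p
occurs-↭ a (swap x y p) with x ≡ᵇ a | y ≡ᵇ a
... | true | true = refl
... | true | false = refl
... | false | true = refl
... | false | false = occurs-↭ a p
occurs-↭ a (↭-trans p q) = trans (occurs-↭ a p) (occurs-↭ a q)

deleteAll-↭ : ∀ a {xs ys} → xs ↭ ys → deleteAll a xs ↭ deleteAll a ys
deleteAll-↭ a ↭-refl = ↭-refl
deleteAll-↭ a (prep x p) with x ≡ᵇ a
... | true = deleteAll-↭ a p
... | false = prep x (deleteAll-↭ a p)
deleteAll-↭ a (swap x y p) with x ≡ᵇ a | y ≡ᵇ a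
... | true | true = deleteAll-↭ a p
... | true | false = prep y (deleteAll-↭ a p)
... | false | true = prep x (deleteAll-↭ a p)
... | false | false = swap x y (deleteAll-↭ a p)
deleteAll-↭ a (↭-trans p q) = ↭-trans (deleteAll-↭ a p) (deleteAll-↭ a q)

↭-replicate-count++deleteAll : ∀ a w → w ↭ replicate (count a w) a ++ deleteAll a w
↭-replicate-count++deleteAll a [] = ↭-refl
↭-replicate-count++deleteAll a (x ∷ w) with x ≡ᵇ a in eq
... | true rewrite ≡ᵇ-true⇒≡ x a eq = prep a (↭-replicate-count++deleteAll a w)
... | false = ↭-trans (prep x (↭-replicate-count++deleteAll a w))
                      (↭-sym (shift x (replicate (count a w) a) (deleteAll a w)))

count-++ : ∀ a xs ys → count a (xs ++ ys) ≡ count a xs + count a ys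
count-++ a [] ys = refl
count-++ a (x ∷ xs) ys with x ≡ᵇ a
... | true = cong suc (count-++ a xs ys)
... | false = count-++ a xs ys

deleteAll-++ : ∀ a xs ys → deleteAll a (xs ++ ys) ≡ deleteAll a xs ++ deleteAll a ys
deleteAll-++ a [] ys = refl
deleteAll-++ a (x ∷ xs) ys with x ≡ᵇ a
... | true = deleteAll-++ a xs ys
... | false = cong (x ∷_) (deleteAll-++ a xs ys)

occurs-++ : ∀ a xs ys → occurs a (xs ++ ys) ≡ (occurs a xs ∨ occurs a ys)
occurs-++ a [] ys = refl
occurs-++ a (x ∷ xs) ys with x ≡ᵇ a
... | true = refl
... | false = occurs-++ a xs ys

occurs-∷ʳ-≢ : ∀ a t xs → t ≢ a → occurs a (xs ++ [ t ]) ≡ occurs a xs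
occurs-∷ʳ-≢ a t xs t≢a rewrite occurs-++ a xs [ t ] | ≢⇒≡ᵇ-false t a t≢a = ∨-identityʳ _

occurs-replicate : ∀ a n → 1 ≤ n → occurs a (replicate n a) ≡ true
occurs-replicate a (suc n) _ rewrite ≡ᵇ-refl a = refl

count-replicate : ∀ a n → count a (replicate n a) ≡ n
count-replicate a zero = refl
count-replicate a (suc n) rewrite ≡ᵇ-refl a = cong suc (count-replicate a n)

deleteAll-replicate : ∀ a n → deleteAll a (replicate n a) ≡ []
deleteAll-replicate a zero = refl
deleteAll-replicate a (suc n) rewrite ≡ᵇ-refl a = deleteAll-replicate a n

deleteAll-avoiding : ∀ a {xs} → Avoids a xs → deleteAll a xs ≡ xs
deleteAll-avoiding a [] = refl
deleteAll-avoiding a {x ∷ xs} (p ∷ ps) rewrite ≢⇒≡ᵇ-false x a p = cong (x ∷_) (deleteAll-avoiding a ps)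

count-avoiding : ∀ a {xs} → Avoids a xs → count a xs ≡ 0
count-avoiding a [] = refl
count-avoiding a {x ∷ xs} (p ∷ ps) rewrite ≢⇒≡ᵇ-false x a p = count-avoiding a ps

deleteAll-avoids : ∀ a xs → Avoids a (deleteAll a xs)
deleteAll-avoids a [] = []
deleteAll-avoids a (x ∷ xs) with x ≡ᵇ a in eq
... | true = deleteAll-avoids a xs
... | false = ≡ᵇ-false⇒≢ x a eq ∷ deleteAll-avoids a xs

occurs-deleteAll : ∀ t a xs → a ≢ t → occurs a (deleteAll t xs) ≡ occurs a xs
occurs-deleteAll t a [] a≢t = refl
occurs-deleteAll t a (x ∷ xs) a≢t with x ≡ᵇ t in e₁ | x ≡ᵇ a in e₂
... | true | true = ⊥-elim (a≢t (trans (sym (≡ᵇ-true⇒≡ x a e₂)) (≡ᵇ-true⇒≡ x t e₁)))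
... | true | false = occurs-deleteAll t a xs a≢t
... | false | true rewrite e₂ = refl
... | false | false rewrite e₂ = occurs-deleteAll t a xs a≢t

occurs-reverse : ∀ a xs → occurs a (reverse xs) ≡ occurs a xs
occurs-reverse a [] = refl
occurs-reverse a (x ∷ xs)
  rewrite List.unfold-reverse x xs | occurs-++ a (reverse xs) [ x ] | occurs-reverse a xs
  with x ≡ᵇ a
... | true = ∨-zeroʳ (occurs a xs)
... | false = ∨-identityʳ (occurs a xs)

deleteAll-reverse : ∀ t w → deleteAll t (reverse w) ≡ reverse (deleteAll t w)
deleteAll-reverse t [] = refl
deleteAll-reverse t (x ∷ w)
  rewrite List.unfold-reverse x w | deleteAll-++ t (reverse w) [ x ] | deleteAll-reverse t w
  with x ≡ᵇ t
... | true = List.++-identityʳ _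
... | false = sym (List.unfold-reverse x (deleteAll t w))

expandAux-∷ʳ : ∀ {m} a (ks : Vec ℕ m) y →
  expandAux a (ks ∷ʳ y) ≡ expandAux a ks ++ replicate y (a + m)
expandAux-∷ʳ a Vec.[] y rewrite +-identityʳ a = List.++-identityʳ (replicate y a)
expandAux-∷ʳ {suc m} a (x Vec.∷ ks) y rewrite expandAux-∷ʳ (suc a) ks y | +-suc a m =
  sym (List.++-assoc (replicate x a) (expandAux (suc a) ks) (replicate y (suc (a + m))))

expandAux-bounds : ∀ {m} a (ks : Vec ℕ m) → All (λ z → a ≤ z × z < a + m) (expandAux a ks)
expandAux-bounds a Vec.[] = []
expandAux-bounds {suc m} a (x Vec.∷ ks) =
  All.++⁺ (All.replicate⁺ x (≤-refl , subst (a <_) (sym (+-suc a m)) (s≤s (m≤m+n a m))))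
          (All.map (λ { {z} (a<z , z<) → ≤-trans (n≤1+n a) a<z , subst (z <_) (sym (+-suc a m)) z< })
                   (expandAux-bounds (suc a) ks))

occurs-expandAux : ∀ {m} (ks : Vec ℕ m) a → (∀ i → 1 ≤ lookup ks i) →
  ∀ j → j < m → occurs (a + j) (expandAux a ks) ≡ true
occurs-expandAux (x Vec.∷ ks) a ks≥1 zero j<m with x | ks≥1 Fin.zero
... | suc _ | _ rewrite +-identityʳ a | ≡ᵇ-refl a = refl
occurs-expandAux (x Vec.∷ ks) a ks≥1 (suc j) (s≤s j<m)
  rewrite occurs-++ (a + suc j) (replicate x a) (expandAux (suc a) ks) | +-suc a j
        | occurs-expandAux ks (suc a) (ks≥1 ∘ Fin.suc) j j<m = ∨-zeroʳ _

lookup-∷ʳ-inject₁ : ∀ {m} (ks : Vec ℕ m) y i → lookup (ks ∷ʳ y) (Fin.inject₁ i) ≡ lookup ks i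
lookup-∷ʳ-inject₁ (x Vec.∷ ks) y Fin.zero = refl
lookup-∷ʳ-inject₁ (x Vec.∷ ks) y (Fin.suc i) = lookup-∷ʳ-inject₁ ks y i

lookup-∷ʳ-last : ∀ {m} (ks : Vec ℕ m) y → lookup (ks ∷ʳ y) (Fin.fromℕ m) ≡ y
lookup-∷ʳ-last Vec.[] y = refl
lookup-∷ʳ-last (x Vec.∷ ks) y = lookup-∷ʳ-last ks y

LastBefore : ℕ → ℕ → List ℕ → Set
LastBefore a b w = ∃[ p ] ∃[ q ] (lastOcc a w ≡ just p × lastOcc b w ≡ just q × p < q)

lastOcc-∷ʳ : ∀ a xs y → lastOcc a (xs ++ [ y ]) ≡ (if y ≡ᵇ a then just (length xs) else lastOcc a xs)
lastOcc-∷ʳ a [] y = refl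
lastOcc-∷ʳ a (x ∷ xs) y with lastOcc a (xs ++ [ y ]) | lastOcc-∷ʳ a xs y
... | _ | e with y ≡ᵇ a
... | true rewrite e = refl
... | false rewrite e = refl

lastOcc-just⇒occurs : ∀ a xs {p} → lastOcc a xs ≡ just p → occurs a xs ≡ true
lastOcc-just⇒occurs a (x ∷ xs) e with lastOcc a xs in e′
... | just q rewrite lastOcc-just⇒occurs a xs e′ with x ≡ᵇ a
...   | true = refl
...   | false = refl
lastOcc-just⇒occurs a (x ∷ xs) e | nothing with x ≡ᵇ a
... | true = refl
lastOcc-just⇒occurs a (x ∷ xs) () | nothing | false

lastOcc-just⇒< : ∀ a xs {p} → lastOcc a xs ≡ just p → p < length xs
lastOcc-just⇒< a (x ∷ xs) e with lastOcc a xs in e′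
... | just q with refl ← e = s≤s (lastOcc-just⇒< a xs e′)
lastOcc-just⇒< a (x ∷ xs) e | nothing with x ≡ᵇ a
... | true with refl ← e = s≤s z≤n
lastOcc-just⇒< a (x ∷ xs) () | nothing | false

occurs⇒lastOcc-just : ∀ a xs → occurs a xs ≡ true → ∃[ p ] lastOcc a xs ≡ just p
occurs⇒lastOcc-just a (x ∷ xs) e with lastOcc a xs in e′
... | just q = suc q , refl
... | nothing with x ≡ᵇ a
...   | true = 0 , refl
...   | false with () ← trans (sym e′) (proj₂ (occurs⇒lastOcc-just a xs e))

LastBefore-∷ʳ : ∀ a t xs → t ≢ a → occurs a xs ≡ true → LastBefore a t (xs ++ [ t ])
LastBefore-∷ʳ a t xs t≢a a∈xs with occurs⇒lastOcc-just a xs a∈xs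
... | p , ep rewrite lastOcc-∷ʳ a xs t | lastOcc-∷ʳ t xs t | ≡ᵇ-refl t | ≢⇒≡ᵇ-false t a t≢a =
  p , length xs , ep , refl , lastOcc-just⇒< a xs ep

¬LastBefore-∷ʳ : ∀ z t xs → z ≢ t → ¬ LastBefore z t (xs ++ [ z ])
¬LastBefore-∷ʳ z t xs z≢t (p , q , ez , et , p<q)
  rewrite lastOcc-∷ʳ z xs z | ≡ᵇ-refl z | lastOcc-∷ʳ t xs z | ≢⇒≡ᵇ-false z t z≢t
  with refl ← ez = <⇒≱ p<q (<⇒≤ (lastOcc-just⇒< t xs et))

-- LastBefore a b (reverse z), decided by scanning z: a b comes before any a and
-- is followed by an a.  Unlike positions, this survives deleting a third letter.
lastBeforeᵇ : ℕ → ℕ → List ℕ → Bool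
lastBeforeᵇ a b [] = false
lastBeforeᵇ a b (x ∷ xs) =
  if x ≡ᵇ b then occurs a xs else (if x ≡ᵇ a then false else lastBeforeᵇ a b xs)

LastBefore⇒lastBeforeᵇ : ∀ a b → a ≢ b → ∀ z → LastBefore a b (reverse z) → lastBeforeᵇ a b z ≡ true
LastBefore⇒lastBeforeᵇ a b a≢b [] (_ , _ , () , _)
LastBefore⇒lastBeforeᵇ a b a≢b (y ∷ z) lb rewrite List.unfold-reverse y z with lb
... | p , q , ea , eb , p<q rewrite lastOcc-∷ʳ a (reverse z) y | lastOcc-∷ʳ b (reverse z) y
  with y ≡ᵇ b in e₁ | y ≡ᵇ a in e₂
... | true | true = ⊥-elim (a≢b (trans (sym (≡ᵇ-true⇒≡ y a e₂)) (≡ᵇ-true⇒≡ y b e₁)))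
... | true | false = trans (sym (occurs-reverse a z)) (lastOcc-just⇒occurs a (reverse z) ea)
... | false | true with refl ← ea = ⊥-elim (<⇒≱ p<q (<⇒≤ (lastOcc-just⇒< b (reverse z) eb)))
... | false | false = LastBefore⇒lastBeforeᵇ a b a≢b z (p , q , ea , eb , p<q)

lastBeforeᵇ⇒LastBefore : ∀ a b → a ≢ b → ∀ z → lastBeforeᵇ a b z ≡ true → LastBefore a b (reverse z)
lastBeforeᵇ⇒LastBefore a b a≢b (y ∷ z) h
  rewrite List.unfold-reverse y z | lastOcc-∷ʳ a (reverse z) y | lastOcc-∷ʳ b (reverse z) y
  with y ≡ᵇ b in e₁ | y ≡ᵇ a in e₂
... | true | true = ⊥-elim (a≢b (trans (sym (≡ᵇ-true⇒≡ y a e₂)) (≡ᵇ-true⇒≡ y b e₁)))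
... | true | false with occurs⇒lastOcc-just a (reverse z) (trans (occurs-reverse a z) h)
...   | p , ep = p , length (reverse z) , ep , refl , lastOcc-just⇒< a (reverse z) ep
lastBeforeᵇ⇒LastBefore a b a≢b (y ∷ z) () | false | true
lastBeforeᵇ⇒LastBefore a b a≢b (y ∷ z) h | false | false = lastBeforeᵇ⇒LastBefore a b a≢b z h

lastBeforeᵇ-deleteAll : ∀ t a b → a ≢ t → b ≢ t → ∀ z →
  lastBeforeᵇ a b (deleteAll t z) ≡ lastBeforeᵇ a b z
lastBeforeᵇ-deleteAll t a b a≢t b≢t [] = refl
lastBeforeᵇ-deleteAll t a b a≢t b≢t (x ∷ z) with x ≡ᵇ t in e
... | true rewrite ≡ᵇ-true⇒≡ x t e | ≢⇒≡ᵇ-false t b (b≢t ∘ sym) | ≢⇒≡ᵇ-false t a (a≢t ∘ sym)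
  = lastBeforeᵇ-deleteAll t a b a≢t b≢t z
... | false rewrite occurs-deleteAll t a z a≢t | lastBeforeᵇ-deleteAll t a b a≢t b≢t z = refl

module _ (t a b : ℕ) (a≢t : a ≢ t) (b≢t : b ≢ t) (a≢b : a ≢ b) where

  private
    toᵇ : ∀ w → LastBefore a b w → lastBeforeᵇ a b (reverse w) ≡ true
    toᵇ w = LastBefore⇒lastBeforeᵇ a b a≢b (reverse w) ∘ subst (LastBefore a b) (sym (List.reverse-involutive w))

    fromᵇ : ∀ w → lastBeforeᵇ a b (reverse w) ≡ true → LastBefore a b w
    fromᵇ w = subst (LastBefore a b) (List.reverse-involutive w) ∘ lastBeforeᵇ⇒LastBefore a b a≢b (reverse w)

    lastBeforeᵇ-reverse-deleteAll : ∀ w → lastBeforeᵇ a b (reverse (deleteAll t w)) ≡ lastBeforeᵇ a b (reverse w)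
    lastBeforeᵇ-reverse-deleteAll w =
      trans (cong (lastBeforeᵇ a b) (sym (deleteAll-reverse t w))) (lastBeforeᵇ-deleteAll t a b a≢t b≢t (reverse w))

  LastBefore-deleteAll⁺ : ∀ w → LastBefore a b w → LastBefore a b (deleteAll t w)
  LastBefore-deleteAll⁺ w lb = fromᵇ (deleteAll t w)
    (trans (lastBeforeᵇ-reverse-deleteAll w) (toᵇ w lb))

  LastBefore-deleteAll⁻ : ∀ w → LastBefore a b (deleteAll t w) → LastBefore a b w
  LastBefore-deleteAll⁻ w lb = fromᵇ w
    (trans (sym (lastBeforeᵇ-reverse-deleteAll w)) (toᵇ (deleteAll t w) lb))

EndsWith : ℕ → List ℕ → Set
EndsWith t w = ∃[ xs ] w ≡ xs ++ [ t ]

EndsWith-∷ : ∀ {t} y {w} → EndsWith t w → EndsWith t (y ∷ w)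
EndsWith-∷ y (xs , w≡) = y ∷ xs , cong (y ∷_) w≡

LastBefore⇒EndsWith : ∀ t w → 1 ≤ count t w → All (λ z → 1 ≤ z × z ≤ t) w →
  (∀ a → 1 ≤ a → a < t → LastBefore a t w) → EndsWith t w
LastBefore⇒EndsWith t w t∈w bounds lb with initLast w
... | [] with () ← t∈w
... | xs ∷ʳ′ z with z ≡ᵇ t in z≡ᵇt
...   | true = xs , cong (λ z → xs ++ [ z ]) (≡ᵇ-true⇒≡ z t z≡ᵇt)
...   | false =
  let z≢t = ≡ᵇ-false⇒≢ z t z≡ᵇt
      z-bounds = proj₂ (All.∷ʳ⁻ bounds)
  in ⊥-elim (¬LastBefore-∷ʳ z t xs z≢t (lb z (proj₁ z-bounds) (≤∧≢⇒< (proj₂ z-bounds) z≢t)))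

module _ {m : ℕ} (ks : Vec ℕ m) (y : ℕ) where
  private
    T = suc m

  expand-∷ʳ : expand (ks ∷ʳ y) ≡ expand ks ++ replicate y T
  expand-∷ʳ = expandAux-∷ʳ 1 ks y

  expand-avoids-new : Avoids T (expand ks)
  expand-avoids-new = All.map (<⇒≢ ∘ proj₂) (expandAux-bounds 1 ks)

  deleteAll-expand-∷ʳ : deleteAll T (expand (ks ∷ʳ y)) ≡ expand ks
  deleteAll-expand-∷ʳ
    rewrite expand-∷ʳ | deleteAll-++ T (expand ks) (replicate y T)
          | deleteAll-avoiding T expand-avoids-new | deleteAll-replicate T y = List.++-identityʳ _

  count-expand-∷ʳ : count T (expand (ks ∷ʳ y)) ≡ y
  count-expand-∷ʳ
    rewrite expand-∷ʳ | count-++ T (expand ks) (replicate y T)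
          | count-avoiding T expand-avoids-new | count-replicate T y = refl

  InS-∷ʳ-bounds : ∀ {w} → InS (ks ∷ʳ y) w → All (λ z → 1 ≤ z × z ≤ T) w
  InS-∷ʳ-bounds perm = All-resp-↭ (↭-sym perm)
    (All.map (map₂ ≤-pred) (expandAux-bounds 1 (ks ∷ʳ y)))

  InP-∷ʳ⁻ : 1 ≤ y → ∀ w → InP (ks ∷ʳ y) w → InP ks (deleteAll T w) × count T w ≡ y × EndsWith T w
  InP-∷ʳ⁻ 1≤y w (perm , ordered) =
    (perm′ , ordered′) , count≡y ,
    LastBefore⇒EndsWith T w (subst (1 ≤_) (sym count≡y) 1≤y) (InS-∷ʳ-bounds perm)
      (λ a 1≤a a<T → ordered a T 1≤a a<T ≤-refl)
    where
    perm′ : deleteAll T w ↭ expand ks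
    perm′ = subst (deleteAll T w ↭_) deleteAll-expand-∷ʳ (deleteAll-↭ T perm)
    ordered′ : ∀ a b → 1 ≤ a → a < b → b ≤ m → LastBefore a b (deleteAll T w)
    ordered′ a b 1≤a a<b b≤m =
      LastBefore-deleteAll⁺ T a b (<⇒≢ (<-trans a<b (s≤s b≤m))) (<⇒≢ (s≤s b≤m)) (<⇒≢ a<b) w
        (ordered a b 1≤a a<b (m≤n⇒m≤1+n b≤m))
    count≡y : count T w ≡ y
    count≡y = trans (count-↭ T perm) count-expand-∷ʳ

  InP-∷ʳ⁺ : (∀ i → 1 ≤ lookup ks i) → ∀ w →
    InP ks (deleteAll T w) → count T w ≡ y → EndsWith T w → InP (ks ∷ʳ y) w
  InP-∷ʳ⁺ ks≥1 w (perm′ , ordered′) count≡y (xs , w≡) = perm , ordered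
    where
    perm : w ↭ expand (ks ∷ʳ y)
    perm = ↭-trans (↭-replicate-count++deleteAll T w)
           (↭-trans (++⁺ˡ (replicate (count T w) T) perm′)
           (↭-trans (++-comm (replicate (count T w) T) (expand ks))
                    (↭-reflexive (trans (cong (λ c → expand ks ++ replicate c T) count≡y)
                                        (sym expand-∷ʳ)))))
    ordered : ∀ a b → 1 ≤ a → a < b → b ≤ T → LastBefore a b w
    ordered a b 1≤a a<b b≤T with m≤n⇒m<n∨m≡n b≤T
    ... | inj₁ (s≤s b≤m) =
      LastBefore-deleteAll⁻ T a b (<⇒≢ (<-trans a<b (s≤s b≤m))) (<⇒≢ (s≤s b≤m)) (<⇒≢ a<b) w
        (ordered′ a b 1≤a a<b b≤m)
    ... | inj₂ refl = subst (LastBefore a T) (sym w≡) (LastBefore-∷ʳ a T xs (a≢T ∘ sym) a∈xs)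
      where
      a≢T = <⇒≢ a<b
      a∈ks : occurs a (expand ks) ≡ true
      a∈ks = subst (λ q → occurs q (expand ks) ≡ true) (m+[n∸m]≡n 1≤a)
               (occurs-expandAux ks 1 ks≥1 (a ∸ 1) (subst (_≤ m) (sym (m+[n∸m]≡n 1≤a)) (≤-pred a<b)))
      a∈w : occurs a (xs ++ [ T ]) ≡ true
      a∈w = subst (λ v → occurs a v ≡ true) w≡
              (trans (sym (occurs-deleteAll T a w a≢T)) (trans (occurs-↭ a perm′) a∈ks))
      a∈xs : occurs a xs ≡ true
      a∈xs = trans (sym (occurs-∷ʳ-≢ a T xs (a≢T ∘ sym))) a∈w

select : (ℕ → Bool) → List ℕ → List ℕ
select f [] = []
select f (x ∷ xs) = if f x then x ∷ select f xs else select f xs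

countBelow : (ℕ → Bool) → ℕ → ℕ
countBelow f zero = 0
countBelow f (suc j) = countBelow f j + (if f j then 1 else 0)

filter-≡false : ∀ (f : ℕ → Bool) xs →
  Data.List.filter (λ i → f i Data.Bool.≟ false) xs ≡ select (not ∘ f) xs
filter-≡false f [] = refl
filter-≡false f (x ∷ xs) with f x
... | true = filter-≡false f xs
... | false = cong (x ∷_) (filter-≡false f xs)

filter-≡true : ∀ (f : ℕ → Bool) xs → Data.List.filter (λ i → f i Data.Bool.≟ true) xs ≡ select f xs
filter-≡true f [] = refl
filter-≡true f (x ∷ xs) with f x
... | true = cong (x ∷_) (filter-≡true f xs)
... | false = filter-≡true f xs

select-cong : ∀ {f g : ℕ → Bool} xs → (∀ i → f i ≡ g i) → select f xs ≡ select g xs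
select-cong [] f≗g = refl
select-cong {f} {g} (x ∷ xs) f≗g rewrite f≗g x with g x
... | true = cong (x ∷_) (select-cong xs f≗g)
... | false = select-cong xs f≗g

select-++ : ∀ f xs ys → select f (xs ++ ys) ≡ select f xs ++ select f ys
select-++ f [] ys = refl
select-++ f (x ∷ xs) ys with f x
... | true = cong (x ∷_) (select-++ f xs ys)
... | false = select-++ f xs ys

select-skip : ∀ f x xs → f x ≡ false → select f (x ∷ xs) ≡ select f xs
select-skip f x xs fx rewrite fx = refl

select-map-suc : ∀ f xs → select f (map suc xs) ≡ map suc (select (f ∘ suc) xs)
select-map-suc f [] = refl
select-map-suc f (x ∷ xs) with f (suc x)
... | true = cong (suc x ∷_) (select-map-suc f xs)
... | false = select-map-suc f xs

select-0∷map-suc : ∀ f xs → select f (0 ∷ map suc xs) ≡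
  (if f 0 then 0 ∷ map suc (select (f ∘ suc) xs) else map suc (select (f ∘ suc) xs))
select-0∷map-suc f xs with f 0
... | true = cong (0 ∷_) (select-map-suc f xs)
... | false = select-map-suc f xs

upTo-suc : ∀ n → upTo (suc n) ≡ 0 ∷ map suc (upTo n)
upTo-suc n = cong (0 ∷_) (sym (List.map-applyUpTo id suc n))

length-select-upTo : ∀ f j → length (select f (upTo j)) ≡ countBelow f j
length-select-upTo f zero = refl
length-select-upTo f (suc j) = begin
  length (select f (upTo (suc j)))            ≡⟨ cong (length ∘ select f) (sym (List.upTo-∷ʳ j)) ⟩
  length (select f (upTo j ++ [ j ]))         ≡⟨ cong length (select-++ f (upTo j) [ j ]) ⟩
  length (select f (upTo j) ++ select f [ j ]) ≡⟨ List.length-++ (select f (upTo j)) ⟩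
  length (select f (upTo j)) + length (select f [ j ])
    ≡⟨ cong₂ _+_ (length-select-upTo f j) (singleton (f j)) ⟩
  countBelow f (suc j)                        ∎
  where
  open ≡-Reasoning
  singleton : ∀ b → length (if b then j ∷ [] else []) ≡ (if b then 1 else 0)
  singleton true = refl
  singleton false = refl

countBelow-mono : ∀ f {g j} → g ≤ j → countBelow f g ≤ countBelow f j
countBelow-mono f {g} {zero} z≤n = ≤-refl
countBelow-mono f {g} {suc j} g≤ with m≤n⇒m<n∨m≡n g≤
... | inj₁ (s≤s g≤j) = ≤-trans (countBelow-mono f g≤j) (m≤m+n _ _)
... | inj₂ refl = ≤-refl

countBelow-< : ∀ f {g j} → g < j → f g ≡ true → countBelow f g < countBelow f j
countBelow-< f {g} g<j fg = ≤-trans step (countBelow-mono f g<j)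
  where
  step : suc (countBelow f g) ≤ countBelow f (suc g)
  step rewrite fg = ≤-reflexive (+-comm 1 (countBelow f g))

countBelow-cong : ∀ f g j → (∀ i → i < j → f i ≡ g i) → countBelow f j ≡ countBelow g j
countBelow-cong f g zero f≗g = refl
countBelow-cong f g (suc j) f≗g =
  cong₂ _+_ (countBelow-cong f g j (λ i i<j → f≗g i (m<n⇒m<1+n i<j)))
            (cong (if_then 1 else 0) (f≗g j ≤-refl))

countBelow-switch : ∀ f g j k → k < j → (∀ i → i ≢ k → f i ≡ g i) → f k ≡ false → g k ≡ true →
  countBelow g j ≡ suc (countBelow f j)
countBelow-switch f g (suc j) k k<j f≗g fk gk with m≤n⇒m<n∨m≡n k<j
... | inj₁ (s≤s k<j′) rewrite countBelow-switch f g j k k<j′ f≗g fk gk | f≗g j (<⇒≢ k<j′ ∘ sym) = refl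
... | inj₂ refl rewrite fk | gk | countBelow-cong f g k (λ i i<k → f≗g i (<⇒≢ i<k)) =
  trans (+-comm (countBelow g k) 1) (cong suc (sym (+-identityʳ _)))

countBelow-⊆ : ∀ f g j → (∀ i → i < j → f i ≡ true → g i ≡ true) → countBelow f j ≤ countBelow g j
countBelow-⊆ f g zero f⊆g = z≤n
countBelow-⊆ f g (suc j) f⊆g = +-mono-≤ (countBelow-⊆ f g j (λ i i<j → f⊆g i (m<n⇒m<1+n i<j))) last
  where
  last : (if f j then 1 else 0) ≤ (if g j then 1 else 0)
  last with f j in fj
  ... | false = z≤n
  ... | true rewrite f⊆g j ≤-refl fj = ≤-refl

countBelow-≤ : ∀ f j → countBelow f j ≤ j
countBelow-≤ f zero = z≤n
countBelow-≤ f (suc j) = subst (countBelow f (suc j) ≤_) (+-comm j 1) (+-mono-≤ (countBelow-≤ f j) last)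
  where
  last : (if f j then 1 else 0) ≤ 1
  last with f j
  ... | true = ≤-refl
  ... | false = z≤n

countBelow-complement : ∀ (f g : ℕ → Bool) → (∀ i → f i ≡ not (g i)) →
  ∀ j → countBelow f j + countBelow g j ≡ j
countBelow-complement f g f≗¬g zero = refl
countBelow-complement f g f≗¬g (suc j) = begin
  (F + a) + (G + b) ≡⟨ +-assoc F a (G + b) ⟩
  F + (a + (G + b)) ≡⟨ cong (F +_) (trans (sym (+-assoc a G b)) (trans (cong (_+ b) (+-comm a G)) (+-assoc G a b))) ⟩
  F + (G + (a + b)) ≡⟨ sym (+-assoc F G (a + b)) ⟩
  (F + G) + (a + b) ≡⟨ cong₂ _+_ (countBelow-complement f g f≗¬g j) one ⟩
  j + 1             ≡⟨ +-comm j 1 ⟩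
  suc j             ∎
  where
  open ≡-Reasoning
  F = countBelow f j
  G = countBelow g j
  a = if f j then 1 else 0
  b = if g j then 1 else 0
  one : a + b ≡ 1
  one rewrite f≗¬g j with g j
  ... | true = refl
  ... | false = refl

at-++ˡ : ∀ (xs ys : List ℕ) i → i < length xs → at (xs ++ ys) i ≡ at xs i
at-++ˡ (x ∷ xs) ys zero _ = refl
at-++ˡ (x ∷ xs) ys (suc i) (s≤s i<) = at-++ˡ xs ys i i<

at-++ʳ : ∀ (xs ys : List ℕ) i → at (xs ++ ys) (length xs + i) ≡ at ys i
at-++ʳ [] ys i = refl
at-++ʳ (x ∷ xs) ys i = at-++ʳ xs ys i

at-map : ∀ (h : ℕ → ℕ) xs i → at (map h xs) i ≡ Maybe.map h (at xs i)
at-map h [] i = refl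
at-map h (x ∷ xs) zero = refl
at-map h (x ∷ xs) (suc i) = at-map h xs i

at-reverse : ∀ (xs : List ℕ) i → i < length xs → at (reverse xs) (length xs ∸ suc i) ≡ at xs i
at-reverse (x ∷ xs) zero _ rewrite List.unfold-reverse x xs =
  trans (cong (at (reverse xs ++ [ x ])) (trans (sym (List.length-reverse xs)) (sym (+-identityʳ _))))
        (at-++ʳ (reverse xs) [ x ] 0)
at-reverse (x ∷ xs) (suc i) (s≤s i<) rewrite List.unfold-reverse x xs =
  trans (at-++ˡ (reverse xs) [ x ] (length xs ∸ suc i)
          (subst (length xs ∸ suc i <_) (sym (List.length-reverse xs)) (∸-monoʳ-< {length xs} z<s i<)))
        (at-reverse xs i i<)

at-< : ∀ (xs : List ℕ) i → i < length xs → ∃[ z ] at xs i ≡ just z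
at-< (x ∷ xs) zero _ = x , refl
at-< (x ∷ xs) (suc i) (s≤s i<) = at-< xs i i<

at-select-upTo : ∀ f j g → g < j → f g ≡ true → at (select f (upTo j)) (countBelow f g) ≡ just g
at-select-upTo f (suc j) g g<j fg = begin
  at (select f (upTo (suc j))) (countBelow f g)
    ≡⟨ cong (λ L → at (select f L) (countBelow f g)) (sym (List.upTo-∷ʳ j)) ⟩
  at (select f (upTo j ++ [ j ])) (countBelow f g)
    ≡⟨ cong (λ L → at L (countBelow f g)) (select-++ f (upTo j) [ j ]) ⟩
  at (select f (upTo j) ++ select f [ j ]) (countBelow f g)
    ≡⟨ split (m≤n⇒m<n∨m≡n g<j) ⟩
  just g ∎
  where
  open ≡-Reasoning
  split : suc g < suc j ⊎ suc g ≡ suc j → at (select f (upTo j) ++ select f [ j ]) (countBelow f g) ≡ just g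
  split (inj₁ (s≤s g<j′)) =
    trans (at-++ˡ (select f (upTo j)) (select f [ j ]) (countBelow f g)
            (subst (countBelow f g <_) (sym (length-select-upTo f j)) (countBelow-< f g<j′ fg)))
          (at-select-upTo f j g g<j′ fg)
  split (inj₂ refl) rewrite fg =
    trans (cong (at (select f (upTo g) ++ [ g ])) (trans (sym (length-select-upTo f g)) (sym (+-identityʳ _))))
          (at-++ʳ (select f (upTo g)) [ g ] 0)

take-replicate++ : ∀ {t} k j (rest : List ℕ) → take (k + j) (replicate k t ++ rest) ≡ replicate k t ++ take j rest
take-replicate++ zero j rest = refl
take-replicate++ {t} (suc k) j rest = cong (t ∷_) (take-replicate++ k j rest)

drop-replicate++ : ∀ {t} k j (rest : List ℕ) → drop (k + j) (replicate k t ++ rest) ≡ drop j rest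
drop-replicate++ zero j rest = refl
drop-replicate++ (suc k) j rest = drop-replicate++ k j rest

replicate++∷ : ∀ {t} k (rest : List ℕ) → replicate k t ++ t ∷ rest ≡ t ∷ replicate k t ++ rest
replicate++∷ zero rest = refl
replicate++∷ {t} (suc k) rest = cong (t ∷_) (replicate++∷ k rest)

insertStep-at : ∀ r t u v i → at (labelled r t v) u ≡ just i → insertStep r t u v ≡ insertAt i t v
insertStep-at r t u v i e with at (labelled r t v) u
insertStep-at r t u v i refl | just .i = refl

-- The gaps of a word and their labels

bump : (ℕ → ℕ) → ℕ → ℕ → ℕ
bump c g h = if h ≡ᵇ g then suc (c h) else c h

bump-≢ : ∀ c g h → h ≢ g → bump c g h ≡ c h
bump-≢ c g h h≢g rewrite ≢⇒≡ᵇ-false h g h≢g = refl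

bump-≡ : ∀ c g → bump c g g ≡ suc (c g)
bump-≡ c g rewrite ≡ᵇ-refl g = refl

data GapKind : Set where
  starredGap neutralGap creatingGap : GapKind

isNeutral : GapKind → Bool
isNeutral neutralGap = true
isNeutral _ = false

isCreating : GapKind → Bool
isCreating creatingGap = true
isCreating _ = false

module Gaps (r T : ℕ) where

  -- createsNew, with the left neighbour of the gap passed along so that it can
  -- be computed by recursion on the word
  createsDescent : Maybe ℕ → ℕ → Bool
  createsDescent nothing y = rdesc r T y
  createsDescent (just a) y = rdesc r T y ∧ not (rdesc r a y)

  createsNewAfter : Maybe ℕ → List ℕ → ℕ → Bool
  createsNewAfter p [] i = false
  createsNewAfter p (b ∷ v) zero = createsDescent p b
  createsNewAfter p (b ∷ v) (suc i) = createsNewAfter (just b) v i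

  gapKind : Maybe ℕ → List ℕ → ℕ → GapKind
  gapKind p [] i = neutralGap
  gapKind p (b ∷ v) zero =
    if b ≡ᵇ T then starredGap else (if createsDescent p b then creatingGap else neutralGap)
  gapKind p (b ∷ v) (suc i) = gapKind (just b) v i

  createsNew-∷∷ : ∀ a b v i → createsNew r T (a ∷ b ∷ v) (suc (suc i)) ≡ createsNew r T (b ∷ v) (suc i)
  createsNew-∷∷ a b v i with at v i
  ... | nothing = refl
  ... | just _ with at (b ∷ v) i
  ...   | nothing = refl
  ...   | just _ = refl

  createsNew-suc : ∀ a v i → createsNew r T (a ∷ v) (suc i) ≡ createsNewAfter (just a) v i
  createsNew-suc a [] i = refl
  createsNew-suc a (b ∷ v) zero = refl
  createsNew-suc a (b ∷ v) (suc i) = trans (createsNew-∷∷ a b v i) (createsNew-suc b v i)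

  createsNew≡createsNewAfter : ∀ v i → createsNew r T v i ≡ createsNewAfter nothing v i
  createsNew≡createsNewAfter [] i = refl
  createsNew≡createsNewAfter (b ∷ v) zero = refl
  createsNew≡createsNewAfter (b ∷ v) (suc i) = createsNew-suc b v i

  isNeutral-gapKind : ∀ p v i → not (starred T v i ∨ createsNewAfter p v i) ≡ isNeutral (gapKind p v i)
  isNeutral-gapKind p [] i = refl
  isNeutral-gapKind p (b ∷ v) zero with b ≡ᵇ T
  ... | true = refl
  ... | false with createsDescent p b
  ...   | true = refl
  ...   | false = refl
  isNeutral-gapKind p (b ∷ v) (suc i) = isNeutral-gapKind (just b) v i

  isCreating-gapKind : ∀ p v i → (not (starred T v i) ∧ createsNewAfter p v i) ≡ isCreating (gapKind p v i)
  isCreating-gapKind p [] i = refl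
  isCreating-gapKind p (b ∷ v) zero with b ≡ᵇ T
  ... | true = refl
  ... | false with createsDescent p b
  ...   | true = refl
  ...   | false = refl
  isCreating-gapKind p (b ∷ v) (suc i) = isCreating-gapKind (just b) v i

  labelled-gapKind : ∀ v → labelled r T v ≡
    reverse (select (isNeutral ∘ gapKind nothing v) (gaps (length v)))
      ++ select (isCreating ∘ gapKind nothing v) (gaps (length v))
  labelled-gapKind v = cong₂ (λ A B → reverse A ++ B)
    (trans (filter-≡false (λ i → starred T v i ∨ createsNew r T v i) (gaps (length v)))
      (select-cong (gaps (length v)) λ i →
        trans (cong (λ z → not (starred T v i ∨ z)) (createsNew≡createsNewAfter v i)) (isNeutral-gapKind nothing v i)))
    (trans (filter-≡true (λ i → not (starred T v i) ∧ createsNew r T v i) (gaps (length v)))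
      (select-cong (gaps (length v)) λ i →
        trans (cong (λ z → not (starred T v i) ∧ z) (createsNew≡createsNewAfter v i)) (isCreating-gapKind nothing v i)))

  -- blocks c x has c g copies of T right before the g-th letter of x
  -- (g = length x: at the end); every word is of this form (blocks-blockSizes).
  blocks : (ℕ → ℕ) → List ℕ → List ℕ
  blocks c [] = replicate (c 0) T ++ []
  blocks c (y ∷ x) = replicate (c 0) T ++ y ∷ blocks (c ∘ suc) x

  -- position in blocks c x of the unstarred gap right after the g-th block
  blockGap : (ℕ → ℕ) → ℕ → ℕ
  blockGap c zero = c 0 + 0
  blockGap c (suc g) = c 0 + suc (blockGap (c ∘ suc) g)

  -- A nonempty block before x_g already makes (T , x_g) a descent, so the gap
  -- after it creates nothing new.
  blockKind : Maybe ℕ → (ℕ → ℕ) → List ℕ → ℕ → GapKind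
  blockKind p c x g = if createsNewAfter p x g ∧ (c g ≡ᵇ 0) then creatingGap else neutralGap

  leftOf : Maybe ℕ → ℕ → Maybe ℕ
  leftOf p zero = p
  leftOf p (suc k) = just T

  length-replicate++ : ∀ k (rest : List ℕ) → length (replicate k T ++ rest) ≡ k + length rest
  length-replicate++ k rest = trans (List.length-++ (replicate k T)) (cong (_+ length rest) (List.length-replicate k))

  select-gapKind-replicate++ : ∀ (sel : GapKind → Bool) → sel starredGap ≡ false → ∀ p k rest →
    select (sel ∘ gapKind p (replicate k T ++ rest)) (upTo (suc (k + length rest)))
     ≡ map (k +_) (select (sel ∘ gapKind (leftOf p k) rest) (upTo (suc (length rest))))
  select-gapKind-replicate++ sel sel⋆ p zero rest = sym (List.map-id _)
  select-gapKind-replicate++ sel sel⋆ p (suc k) rest = begin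
    select F (upTo (suc (suc k + length rest)))      ≡⟨ cong (select F) (upTo-suc (suc (k + length rest))) ⟩
    select F (0 ∷ map suc U)                           ≡⟨ select-skip F 0 (map suc U) F0 ⟩
    select F (map suc U)                               ≡⟨ select-map-suc F U ⟩
    map suc (select (F ∘ suc) U)                       ≡⟨ cong (map suc) (select-gapKind-replicate++ sel sel⋆ (just T) k rest) ⟩
    map suc (map (k +_) (select (sel ∘ gapKind (leftOf (just T) k) rest) V))
      ≡⟨ cong (λ q → map suc (map (k +_) (select (sel ∘ gapKind q rest) V))) (leftOf-T k) ⟩
    map suc (map (k +_) (select (sel ∘ gapKind (just T) rest) V)) ≡⟨ sym (List.map-∘ _) ⟩
    map (suc k +_) (select (sel ∘ gapKind (leftOf p (suc k)) rest) V) ∎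
    where
    open ≡-Reasoning
    F = sel ∘ gapKind p (replicate (suc k) T ++ rest)
    U = upTo (suc (k + length rest))
    V = upTo (suc (length rest))
    F0 : F 0 ≡ false
    F0 rewrite ≡ᵇ-refl T = sel⋆
    leftOf-T : ∀ k → leftOf (just T) k ≡ just T
    leftOf-T zero = refl
    leftOf-T (suc k) = refl

  gapKind-blocks-head : ∀ p c y x v → y ≢ T → gapKind (leftOf p (c 0)) (y ∷ v) 0 ≡ blockKind p c (y ∷ x) 0
  gapKind-blocks-head p c y x v y≢T with c 0
  ... | zero rewrite ≢⇒≡ᵇ-false y T y≢T | ∧-identityʳ (createsDescent p y) = refl
  ... | suc k rewrite ≢⇒≡ᵇ-false y T y≢T | ∧-inverseʳ (rdesc r T y) | ∧-zeroʳ (createsDescent p y) = refl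

  map-+-blockGap : ∀ c b L →
    map (c 0 +_) (if b then 0 ∷ map suc (map (blockGap (c ∘ suc)) L) else map suc (map (blockGap (c ∘ suc)) L))
      ≡ map (blockGap c) (if b then 0 ∷ map suc L else map suc L)
  map-+-blockGap c true L = cong (_ ∷_) (tail L)
    where
    tail : ∀ L → map (c 0 +_) (map suc (map (blockGap (c ∘ suc)) L)) ≡ map (blockGap c) (map suc L)
    tail [] = refl
    tail (g ∷ L) = cong (_ ∷_) (tail L)
  map-+-blockGap c false [] = refl
  map-+-blockGap c false (g ∷ L) = cong (_ ∷_) (map-+-blockGap c false L)

  select-gapKind-blocks : ∀ (sel : GapKind → Bool) → sel starredGap ≡ false → ∀ p c x → Avoids T x →
    select (sel ∘ gapKind p (blocks c x)) (upTo (suc (length (blocks c x)))) ≡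
    map (blockGap c) (select (sel ∘ blockKind p c x) (upTo (suc (length x))))
  select-gapKind-blocks sel sel⋆ p c [] _ =
    trans (cong (λ n → select (sel ∘ gapKind p (blocks c [])) (upTo (suc n))) (length-replicate++ (c 0) []))
     (trans (select-gapKind-replicate++ sel sel⋆ p (c 0) []) (end (sel neutralGap)))
    where
    end : ∀ b → map (c 0 +_) (if b then 0 ∷ [] else []) ≡ map (blockGap c) (if b then 0 ∷ [] else [])
    end true = refl
    end false = refl
  select-gapKind-blocks sel sel⋆ p c (y ∷ x) (y≢T ∷ x-avoids) = begin
    select F (upTo (suc (length (blocks c (y ∷ x)))))
      ≡⟨ cong (λ n → select F (upTo (suc n))) (length-replicate++ (c 0) (y ∷ B)) ⟩
    select F (upTo (suc (c 0 + length (y ∷ B))))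
      ≡⟨ select-gapKind-replicate++ sel sel⋆ p (c 0) (y ∷ B) ⟩
    map (c 0 +_) (select G (upTo (suc (length (y ∷ B)))))
      ≡⟨ cong (λ L → map (c 0 +_) (select G L)) (upTo-suc (suc (length B))) ⟩
    map (c 0 +_) (select G (0 ∷ map suc (upTo (suc (length B)))))
      ≡⟨ cong (map (c 0 +_)) (select-0∷map-suc G (upTo (suc (length B)))) ⟩
    map (c 0 +_) (if G 0 then 0 ∷ map suc (select (G ∘ suc) (upTo (suc (length B))))
                          else map suc (select (G ∘ suc) (upTo (suc (length B)))))
      ≡⟨ cong₂ (λ b L → map (c 0 +_) (if b then 0 ∷ map suc L else map suc L))
               (cong sel (gapKind-blocks-head p c y x B y≢T))
               (select-gapKind-blocks sel sel⋆ (just y) (c ∘ suc) x x-avoids) ⟩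
    map (c 0 +_) (if G′ 0 then 0 ∷ map suc (map (blockGap (c ∘ suc)) S) else map suc (map (blockGap (c ∘ suc)) S))
      ≡⟨ map-+-blockGap c (G′ 0) S ⟩
    map (blockGap c) (if G′ 0 then 0 ∷ map suc S else map suc S)
      ≡⟨ cong (map (blockGap c)) (sym (select-0∷map-suc G′ (upTo (suc (length x))))) ⟩
    map (blockGap c) (select G′ (0 ∷ map suc (upTo (suc (length x)))))
      ≡⟨ cong (λ L → map (blockGap c) (select G′ L)) (sym (upTo-suc (suc (length x)))) ⟩
    map (blockGap c) (select G′ (upTo (suc (length (y ∷ x))))) ∎
    where
    open ≡-Reasoning
    B = blocks (c ∘ suc) x
    F = sel ∘ gapKind p (blocks c (y ∷ x))
    G = sel ∘ gapKind (leftOf p (c 0)) (y ∷ B)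
    G′ = sel ∘ blockKind p c (y ∷ x)
    S = select (sel ∘ blockKind (just y) (c ∘ suc) x) (upTo (suc (length x)))

  insertAt-blocks : ∀ c x g → g ≤ length x → insertAt (blockGap c g) T (blocks c x) ≡ blocks (bump c g) x
  insertAt-blocks c [] zero _
    rewrite take-replicate++ {T} (c 0) 0 [] | drop-replicate++ {T} (c 0) 0 [] =
    trans (List.++-assoc (replicate (c 0) T) [] [ T ]) (replicate++∷ {T} (c 0) [])
  insertAt-blocks c (y ∷ x) zero _
    rewrite take-replicate++ {T} (c 0) 0 (y ∷ blocks (c ∘ suc) x) | drop-replicate++ {T} (c 0) 0 (y ∷ blocks (c ∘ suc) x) =
    trans (List.++-assoc (replicate (c 0) T) [] _) (replicate++∷ {T} (c 0) _)
  insertAt-blocks c (y ∷ x) (suc g) (s≤s g≤)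
    rewrite take-replicate++ {T} (c 0) (suc (blockGap (c ∘ suc) g)) (y ∷ blocks (c ∘ suc) x)
          | drop-replicate++ {T} (c 0) (suc (blockGap (c ∘ suc) g)) (y ∷ blocks (c ∘ suc) x) =
    trans (List.++-assoc (replicate (c 0) T) _ _)
          (cong (λ z → replicate (c 0) T ++ y ∷ z) (insertAt-blocks (c ∘ suc) x g g≤))

  blocks-cong : ∀ {c c′} x → (∀ h → h ≤ length x → c h ≡ c′ h) → blocks c x ≡ blocks c′ x
  blocks-cong [] c≗c′ = cong (λ k → replicate k T ++ []) (c≗c′ 0 z≤n)
  blocks-cong (y ∷ x) c≗c′ =
    cong₂ (λ k w → replicate k T ++ y ∷ w) (c≗c′ 0 z≤n) (blocks-cong x (λ h h≤ → c≗c′ (suc h) (s≤s h≤)))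

  blocks-const-0 : ∀ x → blocks (λ _ → 0) x ≡ x
  blocks-const-0 [] = refl
  blocks-const-0 (y ∷ x) = cong (y ∷_) (blocks-const-0 x)

  blockSizes : List ℕ → ℕ → ℕ
  blockSizes [] = λ _ → 0
  blockSizes (y ∷ v) = if y ≡ᵇ T then bump (blockSizes v) 0 else shiftBlocks (blockSizes v)
    where
    shiftBlocks : (ℕ → ℕ) → ℕ → ℕ
    shiftBlocks c zero = 0
    shiftBlocks c (suc h) = c h

  blocks-bump-0 : ∀ c x → blocks (bump c 0) x ≡ T ∷ blocks c x
  blocks-bump-0 c [] = refl
  blocks-bump-0 c (y ∷ x) = refl

  blocks-blockSizes : ∀ v → blocks (blockSizes v) (deleteAll T v) ≡ v
  blocks-blockSizes [] = refl
  blocks-blockSizes (y ∷ v) with y ≡ᵇ T in y≡ᵇT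
  ... | true = trans (blocks-bump-0 (blockSizes v) (deleteAll T v))
                     (cong₂ _∷_ (sym (≡ᵇ-true⇒≡ y T y≡ᵇT)) (blocks-blockSizes v))
  ... | false = cong (y ∷_) (blocks-blockSizes v)

  createsNewAfter-end : ∀ p x → createsNewAfter p x (length x) ≡ false
  createsNewAfter-end p [] = refl
  createsNewAfter-end p (y ∷ x) = createsNewAfter-end (just y) x

  createsNewAfter⇒< : ∀ p x g → createsNewAfter p x g ≡ true → g < length x
  createsNewAfter⇒< p (y ∷ x) zero _ = s≤s z≤n
  createsNewAfter⇒< p (y ∷ x) (suc g) e = s≤s (createsNewAfter⇒< (just y) x g e)

  module _ (c : ℕ → ℕ) (x : List ℕ) where

    isNeutralGap isCreatingGap : ℕ → Bool
    isNeutralGap = isNeutral ∘ blockKind nothing c x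
    isCreatingGap = isCreating ∘ blockKind nothing c x

    #neutral : ℕ
    #neutral = countBelow isNeutralGap (suc (length x))

    -- as in labelled: neutral gaps from the right, then creating gaps from the left
    neutralLabel creatingLabel : ℕ → ℕ
    neutralLabel g = #neutral ∸ suc (countBelow isNeutralGap g)
    creatingLabel g = #neutral + countBelow isCreatingGap g

    isNeutralGap≡not-isCreatingGap : ∀ g → isNeutralGap g ≡ not (isCreatingGap g)
    isNeutralGap≡not-isCreatingGap g with createsNewAfter nothing x g ∧ (c g ≡ᵇ 0)
    ... | true = refl
    ... | false = refl

    isNeutralGap-end : isNeutralGap (length x) ≡ true
    isNeutralGap-end rewrite createsNewAfter-end nothing x = refl

    neutralLabel-end : neutralLabel (length x) ≡ 0
    neutralLabel-end rewrite isNeutralGap-end | +-comm (countBelow isNeutralGap (length x)) 1 =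
      n∸n≡0 (countBelow isNeutralGap (length x))

    module _ (x-avoids : Avoids T x) where
      private
        G = upTo (suc (length x))
        Ns = map (blockGap c) (select isNeutralGap G)
        Cs = map (blockGap c) (select isCreatingGap G)

        length-Ns : length Ns ≡ #neutral
        length-Ns = trans (List.length-map (blockGap c) (select isNeutralGap G))
                          (length-select-upTo isNeutralGap (suc (length x)))

        length-reverse-Ns : length (reverse Ns) ≡ #neutral
        length-reverse-Ns = trans (List.length-reverse Ns) length-Ns

      labelled-blocks : labelled r T (blocks c x) ≡ reverse Ns ++ Cs
      labelled-blocks = trans (labelled-gapKind (blocks c x))
        (cong₂ (λ A B → reverse A ++ B) (select-gapKind-blocks isNeutral refl nothing c x x-avoids)
                                        (select-gapKind-blocks isCreating refl nothing c x x-avoids))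

      length-labelled-blocks : length (labelled r T (blocks c x)) ≡ suc (length x)
      length-labelled-blocks
        rewrite labelled-blocks | List.length-++ (reverse Ns) {Cs} | length-reverse-Ns
              | List.length-map (blockGap c) (select isCreatingGap G) | length-select-upTo isCreatingGap (suc (length x)) =
        countBelow-complement isNeutralGap isCreatingGap isNeutralGap≡not-isCreatingGap (suc (length x))

      at-labelled-neutral : ∀ g → g ≤ length x → isNeutralGap g ≡ true →
        at (labelled r T (blocks c x)) (neutralLabel g) ≡ just (blockGap c g)
      at-labelled-neutral g g≤ neutral rewrite labelled-blocks = begin
        at (reverse Ns ++ Cs) (neutralLabel g)        ≡⟨ at-++ˡ (reverse Ns) Cs (neutralLabel g) label< ⟩
        at (reverse Ns) (#neutral ∸ suc k)            ≡⟨ cong (λ n → at (reverse Ns) (n ∸ suc k)) (sym length-Ns) ⟩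
        at (reverse Ns) (length Ns ∸ suc k)           ≡⟨ at-reverse Ns k (subst (k <_) (sym length-Ns) k<) ⟩
        at Ns k                                       ≡⟨ at-map (blockGap c) (select isNeutralGap G) k ⟩
        Maybe.map (blockGap c) (at (select isNeutralGap G) k)
          ≡⟨ cong (Maybe.map (blockGap c)) (at-select-upTo isNeutralGap (suc (length x)) g (s≤s g≤) neutral) ⟩
        just (blockGap c g)                           ∎
        where
        open ≡-Reasoning
        k = countBelow isNeutralGap g
        k< : k < #neutral
        k< = countBelow-< isNeutralGap (s≤s g≤) neutral
        label< : neutralLabel g < length (reverse Ns)
        label< = subst (neutralLabel g <_) (sym length-reverse-Ns) (∸-monoʳ-< {#neutral} z<s k<)

      at-labelled-creating : ∀ g → g ≤ length x → isCreatingGap g ≡ true →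
        at (labelled r T (blocks c x)) (creatingLabel g) ≡ just (blockGap c g)
      at-labelled-creating g g≤ creating rewrite labelled-blocks = begin
        at (reverse Ns ++ Cs) (#neutral + k)          ≡⟨ cong (λ n → at (reverse Ns ++ Cs) (n + k)) (sym length-reverse-Ns) ⟩
        at (reverse Ns ++ Cs) (length (reverse Ns) + k) ≡⟨ at-++ʳ (reverse Ns) Cs k ⟩
        at Cs k                                       ≡⟨ at-map (blockGap c) (select isCreatingGap G) k ⟩
        Maybe.map (blockGap c) (at (select isCreatingGap G) k)
          ≡⟨ cong (Maybe.map (blockGap c)) (at-select-upTo isCreatingGap (suc (length x)) g (s≤s g≤) creating) ⟩
        just (blockGap c g)                           ∎
        where
        open ≡-Reasoning
        k = countBelow isCreatingGap g

  insertStep-neutral : ∀ c x → Avoids T x → ∀ g → g ≤ length x → isNeutralGap c x g ≡ true →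
    insertStep r T (neutralLabel c x g) (blocks c x) ≡ blocks (bump c g) x
  insertStep-neutral c x x-avoids g g≤ neutral =
    trans (insertStep-at r T _ _ _ (at-labelled-neutral c x x-avoids g g≤ neutral)) (insertAt-blocks c x g g≤)

  insertStep-creating : ∀ c x → Avoids T x → ∀ g → g ≤ length x → isCreatingGap c x g ≡ true →
    insertStep r T (creatingLabel c x g) (blocks c x) ≡ blocks (bump c g) x
  insertStep-creating c x x-avoids g g≤ creating =
    trans (insertStep-at r T _ _ _ (at-labelled-creating c x x-avoids g g≤ creating)) (insertAt-blocks c x g g≤)

  length-labelled : ∀ v → length (labelled r T v) ≡ suc (length (deleteAll T v))
  length-labelled v = trans (cong (length ∘ labelled r T) (sym (blocks-blockSizes v)))
                            (length-labelled-blocks (blockSizes v) (deleteAll T v) (deleteAll-avoids T v))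

  blockGap-end : ∀ c x → blockGap c (length x) ≡ length (blocks c x)
  blockGap-end c [] = sym (length-replicate++ (c 0) [])
  blockGap-end c (y ∷ x) = trans (cong (λ z → c 0 + suc z) (blockGap-end (c ∘ suc) x))
                                 (sym (length-replicate++ (c 0) (y ∷ blocks (c ∘ suc) x)))

  -- label 0 is the last gap: it is never starred and never creates a descent
  insertStep-zero : ∀ v → insertStep r T 0 v ≡ v ++ [ T ]
  insertStep-zero v = subst (λ z → insertStep r T 0 z ≡ z ++ [ T ]) (blocks-blockSizes v) (begin
    insertStep r T 0 (blocks c x)       ≡⟨ insertStep-at r T 0 _ _ at-0 ⟩
    insertAt (length (blocks c x)) T (blocks c x) ≡⟨ insertAt-length (blocks c x) ⟩
    blocks c x ++ [ T ]                 ∎)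
    where
    open ≡-Reasoning
    c = blockSizes v
    x = deleteAll T v
    at-0 : at (labelled r T (blocks c x)) 0 ≡ just (length (blocks c x))
    at-0 = trans (cong (at (labelled r T (blocks c x))) (sym (neutralLabel-end c x)))
             (trans (at-labelled-neutral c x (deleteAll-avoids T v) (length x) ≤-refl (isNeutralGap-end c x))
                    (cong just (blockGap-end c x)))
    insertAt-length : ∀ (v : List ℕ) → insertAt (length v) T v ≡ v ++ [ T ]
    insertAt-length [] = refl
    insertAt-length (y ∷ v) = cong (y ∷_) (insertAt-length v)

module _ (T : ℕ) where

  length-us : ∀ w → length (us T w) ≡ count T w
  length-us [] = refl
  length-us (x ∷ w) with x ≡ᵇ T
  ... | true = cong suc (length-us w)
  ... | false = length-us w

  countLess≤length-deleteAll : ∀ w → countLess T w ≤ length (deleteAll T w)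
  countLess≤length-deleteAll [] = z≤n
  countLess≤length-deleteAll (x ∷ w) with x <ᵇ T in x<ᵇT
  ... | true rewrite ≢⇒≡ᵇ-false x T (<⇒≢ (<ᵇ-true⇒< x T x<ᵇT)) = s≤s (countLess≤length-deleteAll w)
  ... | false with x ≡ᵇ T
  ...   | true = countLess≤length-deleteAll w
  ...   | false = m≤n⇒m≤1+n (countLess≤length-deleteAll w)

  us-bounded : ∀ w → All (_≤ length (deleteAll T w)) (us T w)
  us-bounded [] = []
  us-bounded (x ∷ w) with x ≡ᵇ T
  ... | true = countLess≤length-deleteAll w ∷ us-bounded w
  ... | false = All.map m≤n⇒m≤1+n (us-bounded w)

  countLess-∷ʳ : ∀ w → countLess T (w ++ [ T ]) ≡ countLess T w
  countLess-∷ʳ [] rewrite ≥⇒<ᵇ-false T T ≤-refl = refl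
  countLess-∷ʳ (x ∷ w) with x <ᵇ T
  ... | true = cong suc (countLess-∷ʳ w)
  ... | false = countLess-∷ʳ w

  us-∷ʳ : ∀ w → us T (w ++ [ T ]) ≡ us T w ++ [ 0 ]
  us-∷ʳ [] rewrite ≡ᵇ-refl T = refl
  us-∷ʳ (x ∷ w) with x ≡ᵇ T
  ... | true = cong₂ _∷_ (countLess-∷ʳ w) (us-∷ʳ w)
  ... | false = us-∷ʳ w

-- Effect of insertions on the other letters

module Insertion (r T : ℕ) where
  open Gaps r T

  deleteAll-insertAt : ∀ i v → deleteAll T (insertAt i T v) ≡ deleteAll T v
  deleteAll-insertAt i v
    rewrite deleteAll-++ T (take i v) (T ∷ drop i v) | ≡ᵇ-refl T
          | sym (deleteAll-++ T (take i v) (drop i v)) | List.take++drop≡id i v = refl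

  count-insertAt : ∀ i v → count T (insertAt i T v) ≡ suc (count T v)
  count-insertAt i v
    rewrite count-++ T (take i v) (T ∷ drop i v) | ≡ᵇ-refl T | +-suc (count T (take i v)) (count T (drop i v))
          | sym (count-++ T (take i v) (drop i v)) | List.take++drop≡id i v = refl

  deleteAll-insertStep : ∀ u v → deleteAll T (insertStep r T u v) ≡ deleteAll T v
  deleteAll-insertStep u v with at (labelled r T v) u
  ... | nothing = refl
  ... | just i = deleteAll-insertAt i v

  count-insertStep : ∀ u v → u ≤ length (deleteAll T v) → count T (insertStep r T u v) ≡ suc (count T v)
  count-insertStep u v u≤ with at-< (labelled r T v) u (subst (u <_) (sym (length-labelled v)) (s≤s u≤))
  ... | i , e = trans (cong (count T) (insertStep-at r T u v i e)) (count-insertAt i v)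

  deleteAll-insertAll : ∀ us v → deleteAll T (insertAll r T us v) ≡ deleteAll T v
  deleteAll-insertAll [] v = refl
  deleteAll-insertAll (u ∷ us) v = trans (deleteAll-insertAll us (insertStep r T u v)) (deleteAll-insertStep u v)

  count-insertAll : ∀ us v → All (_≤ length (deleteAll T v)) us →
    count T (insertAll r T us v) ≡ length us + count T v
  count-insertAll [] v _ = refl
  count-insertAll (u ∷ us) v (u≤ ∷ us≤) =
    trans (count-insertAll us (insertStep r T u v)
             (subst (λ z → All (_≤ length z) us) (sym (deleteAll-insertStep u v)) us≤))
          (trans (cong (length us +_) (count-insertStep u v u≤)) (+-suc (length us) (count T v)))

  insertAll-++ : ∀ us vs v → insertAll r T (us ++ vs) v ≡ insertAll r T vs (insertAll r T us v)
  insertAll-++ [] vs v = refl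
  insertAll-++ (u ∷ us) vs v = insertAll-++ us vs (insertStep r T u v)

  count-insertAll-avoiding : ∀ ls x → Avoids T x → All (_≤ length x) ls → count T (insertAll r T ls x) ≡ length ls
  count-insertAll-avoiding ls x x-avoids ls≤ =
    trans (count-insertAll ls x (subst (λ z → All (_≤ length z) ls) (sym (deleteAll-avoiding T x-avoids)) ls≤))
          (trans (cong (length ls +_) (count-avoiding T x-avoids)) (+-identityʳ _))

  -- a word ending with T has last label 0, which appends T
  insertAll-us-EndsWith : ∀ {w} x → EndsWith T w → EndsWith T (insertAll r T (us T w) x)
  insertAll-us-EndsWith x (xs , refl) = insertAll r T (us T xs) x , (begin
    insertAll r T (us T (xs ++ [ T ])) x          ≡⟨ cong (λ ls → insertAll r T ls x) (us-∷ʳ T xs) ⟩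
    insertAll r T (us T xs ++ [ 0 ]) x            ≡⟨ insertAll-++ (us T xs) [ 0 ] x ⟩
    insertStep r T 0 (insertAll r T (us T xs) x)  ≡⟨ insertStep-zero _ ⟩
    insertAll r T (us T xs) x ++ [ T ]            ∎)
    where open ≡-Reasoning

-- Every word is reached by a nonincreasing sequence of labels

Nonincreasing : List ℕ → Set
Nonincreasing = AllPairs _≥_

Nonincreasing-replicate : ∀ d a → Nonincreasing (replicate d a)
Nonincreasing-replicate zero a = []
Nonincreasing-replicate (suc d) a = All.replicate⁺ d ≤-refl ∷ Nonincreasing-replicate d a

-- Both phases use nonincreasing labels, and every label of the creating phase
-- exceeds every label of the neutral phase.
module Preimage (r T : ℕ) (x : List ℕ) (x-avoids : Avoids T x) (target : ℕ → ℕ) where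
  open Gaps r T
  open Insertion r T

  private
    n = length x

  opens : ℕ → Bool
  opens = createsNewAfter nothing x

  needsCreation : ℕ → Bool
  needsCreation g = opens g ∧ not (target g ≡ᵇ 0)

  neutralAt creatingAt : (ℕ → ℕ) → ℕ → Bool
  neutralAt c = isNeutralGap c x
  creatingAt c = isCreatingGap c x

  nNeutral : (ℕ → ℕ) → ℕ
  nNeutral c = #neutral c x

  creatingAt≡ : ∀ c g → creatingAt c g ≡ (opens g ∧ (c g ≡ᵇ 0))
  creatingAt≡ c g with opens g ∧ (c g ≡ᵇ 0)
  ... | true = refl
  ... | false = refl

  neutralAt≡ : ∀ c g → neutralAt c g ≡ not (opens g ∧ (c g ≡ᵇ 0))
  neutralAt≡ c g with opens g ∧ (c g ≡ᵇ 0)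
  ... | true = refl
  ... | false = refl

  neutralAt-bump-≢ : ∀ c g i → i ≢ g → neutralAt (bump c g) i ≡ neutralAt c i
  neutralAt-bump-≢ c g i i≢g rewrite neutralAt≡ (bump c g) i | neutralAt≡ c i | bump-≢ c g i i≢g = refl

  creatingAt-bump-≢ : ∀ c g i → i ≢ g → creatingAt (bump c g) i ≡ creatingAt c i
  creatingAt-bump-≢ c g i i≢g rewrite creatingAt≡ (bump c g) i | creatingAt≡ c i | bump-≢ c g i i≢g = refl

  neutralAt-bump-≡ : ∀ c g → neutralAt (bump c g) g ≡ true
  neutralAt-bump-≡ c g rewrite neutralAt≡ (bump c g) g | bump-≡ c g | ∧-zeroʳ (opens g) = refl

  neutralAt-bump-neutral : ∀ c g → neutralAt c g ≡ true → ∀ i → neutralAt (bump c g) i ≡ neutralAt c i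
  neutralAt-bump-neutral c g neutral i with i ≟ g
  ... | yes refl = trans (neutralAt-bump-≡ c i) (sym neutral)
  ... | no i≢g = neutralAt-bump-≢ c g i i≢g

  nNeutral-bump-creating : ∀ c g → g ≤ n → creatingAt c g ≡ true → nNeutral (bump c g) ≡ suc (nNeutral c)
  nNeutral-bump-creating c g g≤n creating =
    countBelow-switch (neutralAt c) (neutralAt (bump c g)) (suc n) g (s≤s g≤n)
      (λ i i≢g → sym (neutralAt-bump-≢ c g i i≢g))
      (trans (isNeutralGap≡not-isCreatingGap c x g) (cong not creating)) (neutralAt-bump-≡ c g)

  creatingLabel-bump : ∀ c j → j ≤ n → creatingAt c j ≡ true →
    nNeutral (bump c j) + countBelow (creatingAt (bump c j)) j ≡ suc (creatingLabel c x j)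
  creatingLabel-bump c j j≤n creating
    rewrite countBelow-cong (creatingAt (bump c j)) (creatingAt c) j (λ i i<j → creatingAt-bump-≢ c j i (<⇒≢ i<j))
          | nNeutral-bump-creating c j j≤n creating = refl

  needsCreation⇒< : ∀ j → needsCreation j ≡ true → j < n
  needsCreation⇒< j e = createsNewAfter⇒< nothing x j (∧-conicalˡ (opens j) _ e)

  needsCreation⇒creatingAt : ∀ c j → c j ≡ 0 → needsCreation j ≡ true → creatingAt c j ≡ true
  needsCreation⇒creatingAt c j cj≡0 e rewrite creatingAt≡ c j | cj≡0 | ∧-conicalˡ (opens j) _ e = refl

  creatingPhase : (ℕ → ℕ) → ℕ → List ℕ
  creatingPhase c zero = []
  creatingPhase c (suc j) =
    if needsCreation j then creatingLabel c x j ∷ creatingPhase (bump c j) j else creatingPhase c j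

  afterCreating : (ℕ → ℕ) → ℕ → ℕ → ℕ
  afterCreating c zero = c
  afterCreating c (suc j) = if needsCreation j then afterCreating (bump c j) j else afterCreating c j

  VanishesBelow : (ℕ → ℕ) → ℕ → Set
  VanishesBelow c j = ∀ h → h < j → c h ≡ 0

  VanishesBelow-bump : ∀ c j → VanishesBelow c (suc j) → VanishesBelow (bump c j) j
  VanishesBelow-bump c j c≡0 h h<j = trans (bump-≢ c j h (<⇒≢ h<j)) (c≡0 h (m<n⇒m<1+n h<j))

  VanishesBelow-pred : ∀ c j → VanishesBelow c (suc j) → VanishesBelow c j
  VanishesBelow-pred c j c≡0 h h<j = c≡0 h (m<n⇒m<1+n h<j)

  insertAll-creatingPhase : ∀ c j → VanishesBelow c j →
    insertAll r T (creatingPhase c j) (blocks c x) ≡ blocks (afterCreating c j) x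
  insertAll-creatingPhase c zero _ = refl
  insertAll-creatingPhase c (suc j) c≡0 with needsCreation j in needs
  ... | true =
    trans (cong (insertAll r T (creatingPhase (bump c j) j))
                (insertStep-creating c x x-avoids j (<⇒≤ (needsCreation⇒< j needs))
                  (needsCreation⇒creatingAt c j (c≡0 j ≤-refl) needs)))
          (insertAll-creatingPhase (bump c j) j (VanishesBelow-bump c j c≡0))
  ... | false = insertAll-creatingPhase c j (VanishesBelow-pred c j c≡0)

  nNeutral-afterCreating : ∀ c j → VanishesBelow c j →
    nNeutral (afterCreating c j) ≡ nNeutral c + countBelow needsCreation j
  nNeutral-afterCreating c zero _ = sym (+-identityʳ _)
  nNeutral-afterCreating c (suc j) c≡0 with needsCreation j in needs
  ... | true rewrite nNeutral-afterCreating (bump c j) j (VanishesBelow-bump c j c≡0)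
                   | nNeutral-bump-creating c j (<⇒≤ (needsCreation⇒< j needs))
                       (needsCreation⇒creatingAt c j (c≡0 j ≤-refl) needs) =
    trans (sym (+-suc (nNeutral c) _)) (cong (nNeutral c +_) (+-comm 1 _))
  ... | false = trans (nNeutral-afterCreating c j (VanishesBelow-pred c j c≡0)) (cong (nNeutral c +_) (sym (+-identityʳ _)))

  creatingPhase-< : ∀ c j → VanishesBelow c j →
    All (λ ℓ → suc ℓ ≤ nNeutral c + countBelow (creatingAt c) j) (creatingPhase c j)
  creatingPhase-< c zero _ = []
  creatingPhase-< c (suc j) c≡0 with needsCreation j in needs
  ... | true = head ∷ All.map (λ ℓ< → ≤-trans ℓ< (≤-trans (≤-reflexive (creatingLabel-bump c j j≤n creating)) head))
                               (creatingPhase-< (bump c j) j (VanishesBelow-bump c j c≡0))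
    where
    j≤n = <⇒≤ (needsCreation⇒< j needs)
    creating = needsCreation⇒creatingAt c j (c≡0 j ≤-refl) needs
    head : suc (creatingLabel c x j) ≤ nNeutral c + countBelow (creatingAt c) (suc j)
    head rewrite creating = ≤-reflexive (trans (sym (+-suc (nNeutral c) _)) (cong (nNeutral c +_) (+-comm 1 _)))
  ... | false = All.map (λ ℓ< → ≤-trans ℓ< (+-monoʳ-≤ (nNeutral c) (countBelow-mono (creatingAt c) (n≤1+n j))))
                        (creatingPhase-< c j (VanishesBelow-pred c j c≡0))

  creatingPhase-nonincreasing : ∀ c j → VanishesBelow c j → Nonincreasing (creatingPhase c j)
  creatingPhase-nonincreasing c zero _ = []
  creatingPhase-nonincreasing c (suc j) c≡0 with needsCreation j in needs
  ... | true =
    All.map (λ ℓ< → ≤-pred (≤-trans ℓ< (≤-reflexive (creatingLabel-bump c j (<⇒≤ (needsCreation⇒< j needs))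
                                                      (needsCreation⇒creatingAt c j (c≡0 j ≤-refl) needs)))))
            (creatingPhase-< (bump c j) j (VanishesBelow-bump c j c≡0))
    ∷ creatingPhase-nonincreasing (bump c j) j (VanishesBelow-bump c j c≡0)
  ... | false = creatingPhase-nonincreasing c j (VanishesBelow-pred c j c≡0)

  creatingPhase-≥ : ∀ c j → VanishesBelow c j →
    All (λ ℓ → nNeutral (afterCreating c j) ≤ suc ℓ) (creatingPhase c j)
  creatingPhase-≥ c zero _ = []
  creatingPhase-≥ c (suc j) c≡0 with needsCreation j in needs
  ... | true = head ∷ creatingPhase-≥ (bump c j) j (VanishesBelow-bump c j c≡0)
    where
    needs⊆creating : countBelow needsCreation j ≤ countBelow (creatingAt c) j
    needs⊆creating = countBelow-⊆ needsCreation (creatingAt c) j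
      (λ i i<j → needsCreation⇒creatingAt c i (c≡0 i (m<n⇒m<1+n i<j)))
    head : nNeutral (afterCreating (bump c j) j) ≤ suc (creatingLabel c x j)
    head rewrite nNeutral-afterCreating (bump c j) j (VanishesBelow-bump c j c≡0)
               | nNeutral-bump-creating c j (<⇒≤ (needsCreation⇒< j needs))
                   (needsCreation⇒creatingAt c j (c≡0 j ≤-refl) needs) =
      s≤s (+-monoʳ-≤ (nNeutral c) needs⊆creating)
  ... | false = creatingPhase-≥ c j (VanishesBelow-pred c j c≡0)

  afterCreating-value : ∀ c j h → afterCreating c j h ≡ (if (h <ᵇ j) ∧ needsCreation h then suc (c h) else c h)
  afterCreating-value c zero h = refl
  afterCreating-value c (suc j) h with needsCreation j in needs
  ... | true rewrite afterCreating-value (bump c j) j h with <-cmp h j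
  ...   | tri< h<j _ _ rewrite <⇒<ᵇ-true h<j | <⇒<ᵇ-true (m<n⇒m<1+n h<j) | bump-≢ c j h (<⇒≢ h<j) = refl
  ...   | tri≈ _ refl _ rewrite ≥⇒<ᵇ-false h h ≤-refl | <⇒<ᵇ-true (n<1+n h) | needs | bump-≡ c h = refl
  ...   | tri> _ _ h>j rewrite ≥⇒<ᵇ-false h j (<⇒≤ h>j) | ≥⇒<ᵇ-false h (suc j) h>j | bump-≢ c j h (<⇒≢ h>j ∘ sym) = refl
  afterCreating-value c (suc j) h | false rewrite afterCreating-value c j h with <-cmp h j
  ...   | tri< h<j _ _ rewrite <⇒<ᵇ-true h<j | <⇒<ᵇ-true (m<n⇒m<1+n h<j) = refl
  ...   | tri≈ _ refl _ rewrite ≥⇒<ᵇ-false h h ≤-refl | <⇒<ᵇ-true (n<1+n h) | needs = refl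
  ...   | tri> _ _ h>j rewrite ≥⇒<ᵇ-false h j (<⇒≤ h>j) | ≥⇒<ᵇ-false h (suc j) h>j = refl

  created : ℕ → ℕ
  created h = if needsCreation h then 1 else 0

  mid : ℕ → ℕ
  mid = afterCreating (λ _ → 0) (suc n)

  mid-value : ∀ h → mid h ≡ created h
  mid-value h rewrite afterCreating-value (λ _ → 0) (suc n) h with h <ᵇ suc n in h<ᵇ
  ... | true = refl
  ... | false with needsCreation h in needs
  ...   | false = refl
  ...   | true with () ← trans (sym (<⇒<ᵇ-true (m<n⇒m<1+n (needsCreation⇒< h needs)))) h<ᵇ


  remaining : ℕ → ℕ
  remaining h = target h ∸ created h

  midLabel : ℕ → ℕ
  midLabel = neutralLabel mid x

  neutralPhase : ℕ → ℕ → List ℕ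
  neutralPhase h zero = []
  neutralPhase h (suc f) = replicate (remaining h) (midLabel h) ++ neutralPhase (suc h) f

  SameNeutral : (ℕ → ℕ) → Set
  SameNeutral c = ∀ g → neutralAt c g ≡ neutralAt mid g

  neutralLabel-SameNeutral : ∀ c → SameNeutral c → ∀ h → neutralLabel c x h ≡ midLabel h
  neutralLabel-SameNeutral c same h =
    cong₂ (λ a b → a ∸ suc b) (countBelow-cong _ _ (suc n) (λ i _ → same i)) (countBelow-cong _ _ h (λ i _ → same i))

  bumpTimes : (ℕ → ℕ) → ℕ → ℕ → ℕ → ℕ
  bumpTimes c h zero = c
  bumpTimes c h (suc d) = bumpTimes (bump c h) h d

  bumpTimes-value : ∀ d c h g → bumpTimes c h d g ≡ (if g ≡ᵇ h then d + c g else c g)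
  bumpTimes-value zero c h g with g ≡ᵇ h
  ... | true = refl
  ... | false = refl
  bumpTimes-value (suc d) c h g rewrite bumpTimes-value d (bump c h) h g with g ≡ᵇ h in g≡ᵇh
  ... | true rewrite ≡ᵇ-true⇒≡ g h g≡ᵇh = +-suc d (c h)
  ... | false = refl

  bumpTimes-≢ : ∀ d c h g → g ≢ h → bumpTimes c h d g ≡ c g
  bumpTimes-≢ d c h g g≢h rewrite bumpTimes-value d c h g | ≢⇒≡ᵇ-false g h g≢h = refl

  insertAll-replicate-midLabel : ∀ d c h → h ≤ n → (1 ≤ d → neutralAt c h ≡ true) → SameNeutral c →
    insertAll r T (replicate d (midLabel h)) (blocks c x) ≡ blocks (bumpTimes c h d) x × SameNeutral (bumpTimes c h d)
  insertAll-replicate-midLabel zero c h h≤n _ same = refl , same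
  insertAll-replicate-midLabel (suc d) c h h≤n neutral same =
    trans (cong (insertAll r T (replicate d (midLabel h))) step) (proj₁ rest) , proj₂ rest
    where
    neutral′ = neutral (s≤s z≤n)
    step : insertStep r T (midLabel h) (blocks c x) ≡ blocks (bump c h) x
    step = trans (cong (λ ℓ → insertStep r T ℓ (blocks c x)) (sym (neutralLabel-SameNeutral c same h)))
                 (insertStep-neutral c x x-avoids h h≤n neutral′)
    rest = insertAll-replicate-midLabel d (bump c h) h h≤n
             (λ _ → trans (neutralAt-bump-neutral c h neutral′ h) neutral′)
             (λ g → trans (neutralAt-bump-neutral c h neutral′ g) (same g))

  created≤target : ∀ h → created h ≤ target h
  created≤target h with needsCreation h in needs
  ... | false = z≤n
  ... | true with target h
  ...   | suc _ = s≤s z≤n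
  ...   | zero with () ← trans (sym needs) (∧-zeroʳ (opens h))

  remaining⇒neutral : ∀ h → 1 ≤ remaining h → neutralAt mid h ≡ true
  remaining⇒neutral h 1≤rem rewrite neutralAt≡ mid h | mid-value h with opens h
  ... | false = refl
  ... | true with target h
  ...   | suc _ = refl
  ...   | zero with () ← 1≤rem

  insertAll-neutralPhase : ∀ f h c → h + f ≡ suc n → SameNeutral c →
    (∀ g → g < h → c g ≡ target g) → (∀ g → h ≤ g → c g ≡ mid g) →
    insertAll r T (neutralPhase h f) (blocks c x) ≡ blocks target x
  insertAll-neutralPhase zero h c h≡ _ below _ =
    blocks-cong x (λ g g≤n → below g (subst (g <_) (sym (trans (sym (+-identityʳ h)) h≡)) (s≤s g≤n)))
  insertAll-neutralPhase (suc f) h c h≡ same below above =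
    trans (insertAll-++ (replicate (remaining h) (midLabel h)) (neutralPhase (suc h) f) (blocks c x))
          (trans (cong (insertAll r T (neutralPhase (suc h) f)) (proj₁ fill))
                 (insertAll-neutralPhase f (suc h) c′ (trans (sym (+-suc h f)) h≡) (proj₂ fill) below′ above′))
    where
    h≤n : h ≤ n
    h≤n = ≤-pred (subst (h <_) h≡ (m<m+n h z<s))
    fill = insertAll-replicate-midLabel (remaining h) c h h≤n
             (λ 1≤rem → trans (same h) (remaining⇒neutral h 1≤rem)) same
    c′ = bumpTimes c h (remaining h)
    below′ : ∀ g → g < suc h → c′ g ≡ target g
    below′ g g<1+h with m≤n⇒m<n∨m≡n g<1+h
    ... | inj₁ (s≤s g<h) = trans (bumpTimes-≢ (remaining h) c h g (<⇒≢ g<h)) (below g g<h)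
    ... | inj₂ refl rewrite bumpTimes-value (remaining h) c g g | ≡ᵇ-refl g | above g ≤-refl | mid-value g =
      m∸n+n≡m (created≤target g)
    above′ : ∀ g → suc h ≤ g → c′ g ≡ mid g
    above′ g h<g = trans (bumpTimes-≢ (remaining h) c h g (<⇒≢ h<g ∘ sym)) (above g (<⇒≤ h<g))

  midLabel-antitone : ∀ g h → g ≤ h → midLabel h ≤ midLabel g
  midLabel-antitone g h g≤h = ∸-monoʳ-≤ (nNeutral mid) (s≤s (countBelow-mono (neutralAt mid) g≤h))

  midLabel≤ : ∀ h → midLabel h ≤ nNeutral mid ∸ 1
  midLabel≤ h = ∸-monoʳ-≤ (nNeutral mid) (s≤s z≤n)

  neutralPhase-≤ : ∀ f h → All (_≤ midLabel h) (neutralPhase h f)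
  neutralPhase-≤ zero h = []
  neutralPhase-≤ (suc f) h = All.++⁺ (All.replicate⁺ (remaining h) ≤-refl)
    (All.map (λ ℓ≤ → ≤-trans ℓ≤ (midLabel-antitone h (suc h) (n≤1+n h))) (neutralPhase-≤ f (suc h)))

  neutralPhase-nonincreasing : ∀ f h → Nonincreasing (neutralPhase h f)
  neutralPhase-nonincreasing zero h = []
  neutralPhase-nonincreasing (suc f) h =
    AllPairs.++⁺ (Nonincreasing-replicate (remaining h) (midLabel h)) (neutralPhase-nonincreasing f (suc h))
      (All.replicate⁺ (remaining h)
        (All.map (λ ℓ≤ → ≤-trans ℓ≤ (midLabel-antitone h (suc h) (n≤1+n h))) (neutralPhase-≤ f (suc h))))

  neutralPhase-bounded : ∀ f h → All (_≤ nNeutral mid ∸ 1) (neutralPhase h f)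
  neutralPhase-bounded zero h = []
  neutralPhase-bounded (suc f) h = All.++⁺ (All.replicate⁺ (remaining h) (midLabel≤ h)) (neutralPhase-bounded f (suc h))

  -- the last gap never opens a descent, so all its copies come with label 0
  neutralPhase-zero : ∀ f h → h ≤ n → n < h + f → 1 ≤ target n → occurs 0 (neutralPhase h f) ≡ true
  neutralPhase-zero zero h h≤n n< _ = ⊥-elim (<⇒≱ n< (subst (_≤ n) (sym (+-identityʳ h)) h≤n))
  neutralPhase-zero (suc f) h h≤n n< 1≤target
    rewrite occurs-++ 0 (replicate (remaining h) (midLabel h)) (neutralPhase (suc h) f)
    with m≤n⇒m<n∨m≡n h≤n
  ... | inj₁ h<n rewrite neutralPhase-zero f (suc h) h<n (subst (n <_) (+-suc h f) n<) 1≤target = ∨-zeroʳ _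
  ... | inj₂ refl = cong (_∨ occurs 0 (neutralPhase (suc h) f))
    (subst₂ (λ d ℓ → occurs 0 (replicate d ℓ) ≡ true) (sym remaining-end) (sym (neutralLabel-end mid x))
            (occurs-replicate 0 (target n) 1≤target))
    where
    remaining-end : remaining n ≡ target n
    remaining-end rewrite createsNewAfter-end nothing x = refl

  preimageLabels : List ℕ
  preimageLabels = creatingPhase (λ _ → 0) (suc n) ++ neutralPhase 0 (suc n)

  insertAll-preimageLabels : insertAll r T preimageLabels x ≡ blocks target x
  insertAll-preimageLabels = begin
    insertAll r T preimageLabels x
      ≡⟨ cong (insertAll r T preimageLabels) (sym (blocks-const-0 x)) ⟩
    insertAll r T preimageLabels (blocks (λ _ → 0) x)
      ≡⟨ insertAll-++ (creatingPhase (λ _ → 0) (suc n)) (neutralPhase 0 (suc n)) (blocks (λ _ → 0) x) ⟩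
    insertAll r T (neutralPhase 0 (suc n)) (insertAll r T (creatingPhase (λ _ → 0) (suc n)) (blocks (λ _ → 0) x))
      ≡⟨ cong (insertAll r T (neutralPhase 0 (suc n))) (insertAll-creatingPhase (λ _ → 0) (suc n) (λ _ _ → refl)) ⟩
    insertAll r T (neutralPhase 0 (suc n)) (blocks mid x)
      ≡⟨ insertAll-neutralPhase (suc n) 0 mid refl (λ _ → refl) (λ _ ()) (λ _ _ → refl) ⟩
    blocks target x ∎
    where open ≡-Reasoning

  preimageLabels-nonincreasing : Nonincreasing preimageLabels
  preimageLabels-nonincreasing =
    AllPairs.++⁺ (creatingPhase-nonincreasing (λ _ → 0) (suc n) (λ _ _ → refl)) (neutralPhase-nonincreasing (suc n) 0)
      (All.map (λ mid≤ → All.map (λ ℓ≤ → ≤-trans ℓ≤ (∸-monoˡ-≤ 1 mid≤)) (neutralPhase-bounded (suc n) 0))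
               (creatingPhase-≥ (λ _ → 0) (suc n) (λ _ _ → refl)))

  preimageLabels-bounded : All (_≤ n) preimageLabels
  preimageLabels-bounded = All.++⁺
    (All.map (λ ℓ< → ≤-pred (≤-trans ℓ< (≤-reflexive
               (countBelow-complement (neutralAt (λ _ → 0)) (creatingAt (λ _ → 0))
                                      (isNeutralGap≡not-isCreatingGap (λ _ → 0) x) (suc n)))))
             (creatingPhase-< (λ _ → 0) (suc n) (λ _ _ → refl)))
    (All.map (λ ℓ≤ → ≤-trans ℓ≤ (∸-monoˡ-≤ 1 (countBelow-≤ (neutralAt mid) (suc n)))) (neutralPhase-bounded (suc n) 0))

  preimageLabels-zero : 1 ≤ target n → occurs 0 preimageLabels ≡ true
  preimageLabels-zero 1≤target
    rewrite occurs-++ 0 (creatingPhase (λ _ → 0) (suc n)) (neutralPhase 0 (suc n))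
          | neutralPhase-zero (suc n) 0 z≤n ≤-refl 1≤target = ∨-zeroʳ _

-- Recovering a word from its sequence u and the word without T

module Plant (T : ℕ) where

  -- put T in front of the suffix with exactly u letters
  plant : List ℕ → List ℕ → List ℕ
  plant [] w = w
  plant (u ∷ ls) [] = T ∷ plant ls []
  plant (u ∷ ls) (y ∷ w) = if u ≡ᵇ suc (length w) then T ∷ plant ls (y ∷ w) else y ∷ plant (u ∷ ls) w

  private
    countLess-T∷ : ∀ z → countLess T (T ∷ z) ≡ countLess T z
    countLess-T∷ z rewrite ≥⇒<ᵇ-false T T ≤-refl = refl

    countLess-<∷ : ∀ {y} z → y < T → countLess T (y ∷ z) ≡ suc (countLess T z)
    countLess-<∷ z y<T rewrite <⇒<ᵇ-true y<T = refl

    us-T∷ : ∀ z → us T (T ∷ z) ≡ countLess T z ∷ us T z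
    us-T∷ z rewrite ≡ᵇ-refl T = refl

    us-≢∷ : ∀ {y} z → y ≢ T → us T (y ∷ z) ≡ us T z
    us-≢∷ {y} z y≢T rewrite ≢⇒≡ᵇ-false y T y≢T = refl

    deleteAll-T∷ : ∀ z → deleteAll T (T ∷ z) ≡ deleteAll T z
    deleteAll-T∷ z rewrite ≡ᵇ-refl T = refl

    deleteAll-≢∷ : ∀ {y} z → y ≢ T → deleteAll T (y ∷ z) ≡ y ∷ deleteAll T z
    deleteAll-≢∷ {y} z y≢T rewrite ≢⇒≡ᵇ-false y T y≢T = refl

  -- case analysis by a sum rather than with, so that termination (lexicographic
  -- in the labels and the word) stays visible
  plant-step : ∀ u ls y w →
    (u ≡ suc (length w) × plant (u ∷ ls) (y ∷ w) ≡ T ∷ plant ls (y ∷ w)) ⊎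
    (u ≢ suc (length w) × plant (u ∷ ls) (y ∷ w) ≡ y ∷ plant (u ∷ ls) w)
  plant-step u ls y w with u ≡ᵇ suc (length w) in u≡ᵇ
  ... | true = inj₁ (≡ᵇ-true⇒≡ _ _ u≡ᵇ , refl)
  ... | false = inj₂ (≡ᵇ-false⇒≢ _ _ u≡ᵇ , refl)

  countLess-plant : ∀ ls w → All (_< T) w → countLess T (plant ls w) ≡ length w
  countLess-plant [] [] _ = refl
  countLess-plant [] (y ∷ w) (y<T ∷ w<T) = trans (countLess-<∷ w y<T) (cong suc (countLess-plant [] w w<T))
  countLess-plant (u ∷ ls) [] _ = trans (countLess-T∷ (plant ls [])) (countLess-plant ls [] [])
  countLess-plant (u ∷ ls) (y ∷ w) (y<T ∷ w<T) = [
    (λ step → trans (cong (countLess T) (proj₂ step))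
                (trans (countLess-T∷ (plant ls (y ∷ w))) (countLess-plant ls (y ∷ w) (y<T ∷ w<T)))) ,
    (λ step → trans (cong (countLess T) (proj₂ step))
                (trans (countLess-<∷ (plant (u ∷ ls) w) y<T) (cong suc (countLess-plant (u ∷ ls) w w<T)))) ]′
    (plant-step u ls y w)

  us-avoiding : ∀ {w} → Avoids T w → us T w ≡ []
  us-avoiding [] = refl
  us-avoiding {y ∷ w} (y≢T ∷ w≢T) = trans (us-≢∷ w y≢T) (us-avoiding w≢T)

  us-plant : ∀ ls w → Nonincreasing ls → All (_≤ length w) ls → All (_< T) w → us T (plant ls w) ≡ ls
  us-plant [] w _ _ w<T = us-avoiding (All.map <⇒≢ w<T)
  us-plant (u ∷ ls) [] (_ ∷ ls↓) (z≤n ∷ ls≤) _ =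
    trans (us-T∷ (plant ls [])) (cong₂ _∷_ (countLess-plant ls [] []) (us-plant ls [] ls↓ ls≤ []))
  us-plant (u ∷ ls) (y ∷ w) (u≥ls ∷ ls↓) (u≤ ∷ ls≤) (y<T ∷ w<T) = [
    (λ step → trans (cong (us T) (proj₂ step)) (trans (us-T∷ (plant ls (y ∷ w)))
      (cong₂ _∷_ (trans (countLess-plant ls (y ∷ w) (y<T ∷ w<T)) (sym (proj₁ step)))
                 (us-plant ls (y ∷ w) ls↓ ls≤ (y<T ∷ w<T))))) ,
    (λ step → trans (cong (us T) (proj₂ step)) (trans (us-≢∷ (plant (u ∷ ls) w) (<⇒≢ y<T))
      (us-plant (u ∷ ls) w (u≥ls ∷ ls↓) (u≤w (proj₁ step) ∷ All.map (λ v≤u → ≤-trans v≤u (u≤w (proj₁ step))) u≥ls)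
                w<T))) ]′
    (plant-step u ls y w)
    where
    u≤w : u ≢ suc (length w) → u ≤ length w
    u≤w u≢ = ≤-pred (≤∧≢⇒< u≤ u≢)

  count-plant : ∀ ls w → Nonincreasing ls → All (_≤ length w) ls → All (_< T) w →
    count T (plant ls w) ≡ length ls
  count-plant ls w ls↓ ls≤ w<T = trans (sym (length-us T (plant ls w))) (cong length (us-plant ls w ls↓ ls≤ w<T))

  deleteAll-plant : ∀ ls w → All (_< T) w → deleteAll T (plant ls w) ≡ w
  deleteAll-plant [] w w<T = deleteAll-avoiding T (All.map <⇒≢ w<T)
  deleteAll-plant (u ∷ ls) [] _ = trans (deleteAll-T∷ (plant ls [])) (deleteAll-plant ls [] [])
  deleteAll-plant (u ∷ ls) (y ∷ w) (y<T ∷ w<T) = [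
    (λ step → trans (cong (deleteAll T) (proj₂ step))
                (trans (deleteAll-T∷ (plant ls (y ∷ w))) (deleteAll-plant ls (y ∷ w) (y<T ∷ w<T)))) ,
    (λ step → trans (cong (deleteAll T) (proj₂ step))
                (trans (deleteAll-≢∷ (plant (u ∷ ls) w) (<⇒≢ y<T)) (cong (y ∷_) (deleteAll-plant (u ∷ ls) w w<T)))) ]′
    (plant-step u ls y w)

  plant-≤ : ∀ ls w → All (_< T) w → All (_≤ T) (plant ls w)
  plant-≤ [] w w<T = All.map <⇒≤ w<T
  plant-≤ (u ∷ ls) [] _ = ≤-refl ∷ plant-≤ ls [] []
  plant-≤ (u ∷ ls) (y ∷ w) (y<T ∷ w<T) = [
    (λ step → subst (All (_≤ T)) (sym (proj₂ step)) (≤-refl ∷ plant-≤ ls (y ∷ w) (y<T ∷ w<T))) ,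
    (λ step → subst (All (_≤ T)) (sym (proj₂ step)) (<⇒≤ y<T ∷ plant-≤ (u ∷ ls) w w<T)) ]′
    (plant-step u ls y w)

  countLess≡0⇒replicate : ∀ w → countLess T w ≡ 0 → All (_≤ T) w → w ≡ replicate (length w) T
  countLess≡0⇒replicate [] _ _ = refl
  countLess≡0⇒replicate (y ∷ w) none (y≤T ∷ w≤T) with y <ᵇ T in y<ᵇT
  ... | false = cong₂ _∷_ (≤-antisym y≤T (<ᵇ-false⇒≥ y T y<ᵇT))
                          (countLess≡0⇒replicate w none w≤T)

  -- the T with u = 0 has only copies of T to its right
  occurs-0-us⇒EndsWith : ∀ w → All (_≤ T) w → occurs 0 (us T w) ≡ true → EndsWith T w
  occurs-0-us⇒EndsWith (y ∷ w) (y≤T ∷ w≤T) 0∈ with y ≡ᵇ T in y≡ᵇT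
  ... | false = EndsWith-∷ y (occurs-0-us⇒EndsWith w w≤T 0∈)
  ... | true with countLess T w ≡ᵇ 0 in none
  ...   | false = EndsWith-∷ y (occurs-0-us⇒EndsWith w w≤T 0∈)
  ...   | true rewrite ≡ᵇ-true⇒≡ y T y≡ᵇT | countLess≡0⇒replicate w (≡ᵇ-true⇒≡ _ 0 none) w≤T =
    replicate (length w) T , sym (trans (replicate++∷ (length w) []) (cong (T ∷_) (List.++-identityʳ _)))

blockSizes-last : ∀ r T xs → 1 ≤ Gaps.blockSizes r T (xs ++ [ T ]) (length (deleteAll T (xs ++ [ T ])))
blockSizes-last r T [] rewrite ≡ᵇ-refl T = s≤s z≤n
blockSizes-last r T (y ∷ xs) with y ≡ᵇ T
... | true with length (deleteAll T (xs ++ [ T ])) | blockSizes-last r T xs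
...   | zero | _ = s≤s z≤n
...   | suc _ | last≥1 = last≥1
blockSizes-last r T (y ∷ xs) | false = blockSizes-last r T xs

module Step (r : ℕ) {m : ℕ} (ks : Vec ℕ m) (y : ℕ) (ks≥1 : ∀ i → 1 ≤ lookup ks i) (1≤y : 1 ≤ y) where
  private
    T = suc m
  open Gaps r T
  open Insertion r T
  open Plant T

  InS-< : ∀ {w} → InS ks w → All (_< T) w
  InS-< perm = All-resp-↭ (↭-sym perm) (All.map proj₂ (expandAux-bounds 1 ks))

  length-InS : ∀ {v w} → InS ks v → InS ks w → length v ≡ length w
  length-InS v↭ w↭ = trans (↭-length v↭) (sym (↭-length w↭))

  R-preserves-InP : (∀ w → InP ks w → InP ks (R r m w)) → ∀ w → InP (ks ∷ʳ y) w → InP (ks ∷ʳ y) (R r T w)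
  R-preserves-InP R-preserves w w∈P with InP-∷ʳ⁻ ks y 1≤y w w∈P
  ... | w′∈P , count≡y , ends =
    InP-∷ʳ⁺ ks y ks≥1 Z (subst (InP ks) (sym deleteAll-Z) X∈P) count-Z≡y (insertAll-us-EndsWith X ends)
    where
    X = R r m (deleteAll T w)
    X∈P = R-preserves (deleteAll T w) w′∈P
    X-avoids = All.map <⇒≢ (InS-< (proj₁ X∈P))
    Z = insertAll r T (us T w) X
    deleteAll-Z : deleteAll T Z ≡ X
    deleteAll-Z = trans (deleteAll-insertAll (us T w) X) (deleteAll-avoiding T X-avoids)
    count-Z≡y : count T Z ≡ y
    count-Z≡y = trans (count-insertAll-avoiding (us T w) X X-avoids
                        (subst (λ L → All (_≤ L) (us T w)) (length-InS (proj₁ w′∈P) (proj₁ X∈P)) (us-bounded T w)))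
                      (trans (length-us T w) count≡y)

  R-plant : ∀ ls w → Nonincreasing ls → All (_≤ length w) ls → All (_< T) w →
    R r T (plant ls w) ≡ insertAll r T ls (R r m w)
  R-plant ls w ls↓ ls≤ w<T = cong₂ (insertAll r T) (us-plant ls w ls↓ ls≤ w<T) (cong (R r m) (deleteAll-plant ls w w<T))

  R-onto-InP : (∀ v → InP ks v → ∃[ w ] (InP ks w × R r m w ≡ v)) →
    ∀ v → InP (ks ∷ʳ y) v → ∃[ w ] (InP (ks ∷ʳ y) w × R r T w ≡ v)
  R-onto-InP R-onto v v∈P with InP-∷ʳ⁻ ks y 1≤y v v∈P
  ... | v′∈P , count≡y , (xs , v≡) with R-onto (deleteAll T v) v′∈P
  ...   | w′ , w′∈P , Rw′≡v′ = w , InP-∷ʳ⁺ ks y ks≥1 w w′∈P′ count-w≡y ends , Rw≡v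
    where
    v′ = deleteAll T v
    v′-avoids = deleteAll-avoids T v
    open Preimage r T v′ v′-avoids (blockSizes v)
    w′<T = InS-< (proj₁ w′∈P)
    labels-bounded : All (_≤ length w′) preimageLabels
    labels-bounded = subst (λ L → All (_≤ L) preimageLabels) (length-InS (proj₁ v′∈P) (proj₁ w′∈P))
                           preimageLabels-bounded
    w = plant preimageLabels w′
    reach : insertAll r T preimageLabels v′ ≡ v
    reach = trans insertAll-preimageLabels (blocks-blockSizes v)
    Rw≡v : R r T w ≡ v
    Rw≡v = trans (R-plant preimageLabels w′ preimageLabels-nonincreasing labels-bounded w′<T)
                 (trans (cong (insertAll r T preimageLabels) Rw′≡v′) reach)
    w′∈P′ : InP ks (deleteAll T w)
    w′∈P′ = subst (InP ks) (sym (deleteAll-plant preimageLabels w′ w′<T)) w′∈P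
    count-w≡y : count T w ≡ y
    count-w≡y = begin
      count T w                                 ≡⟨ count-plant preimageLabels w′ preimageLabels-nonincreasing labels-bounded w′<T ⟩
      length preimageLabels                     ≡⟨ count-insertAll-avoiding preimageLabels v′ v′-avoids preimageLabels-bounded ⟨
      count T (insertAll r T preimageLabels v′) ≡⟨ cong (count T) reach ⟩
      count T v                                 ≡⟨ count≡y ⟩
      y                                         ∎
      where open ≡-Reasoning
    ends : EndsWith T w
    ends = occurs-0-us⇒EndsWith w (plant-≤ preimageLabels w′ w′<T)
      (subst (λ z → occurs 0 z ≡ true) (sym (us-plant preimageLabels w′ preimageLabels-nonincreasing labels-bounded w′<T))
        (preimageLabels-zero (subst (λ z → 1 ≤ blockSizes z (length (deleteAll T z))) (sym v≡) (blockSizes-last r T xs))))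

-- The hypothesis 1 ≤ r only makes createsNew agree with the paper's notion of
-- a new r-descent; the argument itself does not use it.
proposition7p1 : (m : ℕ) (k : Vec ℕ m) → (∀ i → 1 ≤ lookup k i) →
    (r : ℕ) → 1 ≤ r →
    ((w : List ℕ) → InP k w → InP k (R r m w)) ×
    ((v : List ℕ) → InP k v → ∃[ w ] (InP k w × R r m w ≡ v))
proposition7p1 zero Vec.[] _ r _ = (λ w w∈P → w∈P) , (λ v v∈P → v , v∈P , refl)
proposition7p1 (suc m) k k≥1 r 1≤r with Vec.initLast k
... | ks , y , refl =
  Step.R-preserves-InP r ks y ks≥1 1≤y (proj₁ IH) , Step.R-onto-InP r ks y ks≥1 1≤y (proj₂ IH)
  where
  ks≥1 : ∀ i → 1 ≤ lookup ks i
  ks≥1 i = subst (1 ≤_) (lookup-∷ʳ-inject₁ ks y i) (k≥1 (Fin.inject₁ i))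
  1≤y : 1 ≤ y
  1≤y = subst (1 ≤_) (lookup-∷ʳ-last ks y) (k≥1 (Fin.fromℕ m))
  IH = proposition7p1 m ks ks≥1 r 1≤r
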